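{- Let $\mathcal C$ be a class of finite simple graphs such that $$\limsup_{r\to\infty}\frac{\log\nabla_r(\mathcal C)}{r}\leq\frac{1}{20}.$$ Then there is an integer $g$ such that every graph $G\in\mathcal C$ with girth at least $g$ has oriented chromatic number at most $5$; in fact every orientation of such a $G$ admits a homomorphism to the tournament $\vec C_5^2$. -}

module Defs where

open import Data.Nat using (ℕ; zero; suc; _+_; _*_; _^_; _≤_; _<_; _%_; _<ᵇ_)
open import Data.Fin using (Fin; toℕ; inject₁; fromℕ) renaming (zero to fzero; suc to fsuc)
open import Data.Bool using (Bool; true; false; _∧_; if_then_else_)
open import Data.List using (List; map; allFin)
open import Data.Nat.ListAction using (sum)
open import Data.Maybe using (Maybe; just)
open import Data.Product using (Σ; ∃; ∃-syntax; _×_)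
open import Data.Sum using (_⊎_)
open import Function.Definitions using (Injective)
open import Relation.Binary.PropositionalEquality using (_≡_)

record Graph : Set where
  field
    n       : ℕ
    adj     : Fin n → Fin n → Bool
    adj-sym : ∀ u v → adj u v ≡ adj v u
    adj-irr : ∀ u → adj u u ≡ false
open Graph public

Adj : (G : Graph) → Fin (n G) → Fin (n G) → Set
Adj G u v = adj G u v ≡ true

edgeCount : Graph → ℕ
edgeCount G = sum (map (λ u → sum (map (λ v →
  if (toℕ u <ᵇ toℕ v) ∧ adj G u v then 1 else 0) (allFin (n G)))) (allFin (n G)))

data WalkIn (G : Graph) (P : Fin (n G) → Set) : Fin (n G) → Fin (n G) → ℕ → Set where
  stay : ∀ {u} → P u → WalkIn G P u u 0
  step : ∀ {u w v k} → P u → Adj G u w → WalkIn G P w v k → WalkIn G P u v (suc k)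

-- The branch sets are encoded by a partial map
-- β : V(G) → Maybe V(H) (β v = just i iff v ∈ V_i), so disjointness is built in.

record ShallowMinor (r : ℕ) (H G : Graph) : Set where
  field
    β       : Fin (n G) → Maybe (Fin (n H))
    centre  : Fin (n H) → Fin (n G)
    centre∈ : ∀ i → β (centre i) ≡ just i
    radius  : ∀ i v → β v ≡ just i →
              ∃[ k ] (k ≤ r × WalkIn G (λ w → β w ≡ just i) (centre i) v k)
    edges   : ∀ i j → Adj H i j →
              ∃[ u ] ∃[ v ] (β u ≡ just i × β v ≡ just j × Adj G u v)

GraphClass : Set₁
GraphClass = Graph → Set

-- ∇_r(C) ≤ p^r / q^r : every depth-r shallow minor H of every G ∈ C has
-- |E(H)| / |V(H)| ≤ (p/q)^r  (written multiplicatively in ℕ).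
GradBound : GraphClass → ℕ → ℕ → ℕ → Set
GradBound C p q r = ∀ G → C G → ∀ H → ShallowMinor r H G →
  edgeCount H * q ^ r ≤ p ^ r * n H

-- (p/q)^20 > e, expressed without reals: since (1+1/m)^(m+1) decreases
-- strictly to e, c^20 > e iff c^20 > (1+1/m)^(m+1) for some m ≥ 1.
AboveE : ℕ → ℕ → Set
AboveE p q = ∃[ m ] (1 ≤ m × (suc m) ^ (suc m) * q ^ 20 < p ^ 20 * m ^ (suc m))

-- limsup_{r→∞} log ∇_r(C) / r ≤ 1/20, equivalently: for every rational
-- c = p/q > e^(1/20) we have ∇_r(C) ≤ c^r for all sufficiently large r.
LimsupCondition : GraphClass → Set
LimsupCondition C = ∀ p q → 1 ≤ q → AboveE p q →
  ∃[ R ] (∀ r → R ≤ r → GradBound C p q r)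

record Cycle (G : Graph) (m : ℕ) : Set where
  field
    f      : Fin (3 + m) → Fin (n G)
    inj    : Injective _≡_ _≡_ f
    consec : ∀ (i : Fin (2 + m)) → Adj G (f (inject₁ i)) (f (fsuc i))
    close  : Adj G (f (fromℕ (2 + m))) (f fzero)

GirthAtLeast : ℕ → Graph → Set
GirthAtLeast g G = ∀ m → Cycle G m → g ≤ 3 + m

record Orientation (G : Graph) : Set where
  field
    arc      : Fin (n G) → Fin (n G) → Bool
    arc⇒adj  : ∀ u v → arc u v ≡ true → Adj G u v
    adj⇒arc  : ∀ u v → Adj G u v → (arc u v ≡ true) ⊎ (arc v u ≡ true)
    antisym  : ∀ u v → arc u v ≡ true → arc v u ≡ false

record OrientedGraph (k : ℕ) : Set where
  field
    darc    : Fin k → Fin k → Bool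
    irr     : ∀ x → darc x x ≡ false
    antisym : ∀ x y → darc x y ≡ true → darc y x ≡ false

HomTo : (G : Graph) → Orientation G → (k : ℕ) → (Fin k → Fin k → Set) → Set
HomTo G o k T = Σ (Fin (n G) → Fin k) λ φ →
  ∀ u v → Orientation.arc o u v ≡ true → T (φ u) (φ v)

OrientedChromaticAtMost : ℕ → Graph → Set
OrientedChromaticAtMost k G = ∀ (o : Orientation G) →
  ∃[ j ] (j ≤ k × Σ (OrientedGraph j) λ D →
    HomTo G o j (λ x y → OrientedGraph.darc D x y ≡ true))

C5²-arc : Fin 5 → Fin 5 → Set
C5²-arc i j = (toℕ j ≡ (toℕ i + 1) % 5) ⊎ (toℕ j ≡ (toℕ i + 2) % 5)

-- Fix an orientation and colour a vertex set S of G by induction on |S|. Every vertex of C₅² has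
-- an in- and an out-neighbour, so a vertex with at most one neighbour in S can be coloured last.
-- C₅² has walks of length 4 of every orientation pattern between any two vertices, so the inner
-- vertices a, b, c of a thread u a b c v, a path whose inner vertices have no further neighbours
-- in S, can be coloured last as well. A set S without these configurations has minimum degree 2
-- and branches within every three steps. Choose a maximal set of centres in S at pairwise distance
-- > M and their Voronoi cells. From each centre, 2^j non-backtracking walks with 3j + 1 edges stay
-- inside its cell, and when the girth is large they leave it into 2^j distinct neighbouring cells.
-- Contracting the cells gives a shallow minor of depth M = 6j + 2 and edge density at least
-- 2^(j-1) > (53/50)^M, which contradicts the limsup condition for large j.

module Submission where

open import Defs
open import Data.Bool using (Bool; true; false; T; _∧_; if_then_else_)
import Data.Bool.Properties as Bool
open import Data.Empty using (⊥; ⊥-elim)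
open import Data.Fin using (Fin; toℕ; inject₁; fromℕ; remQuot; combine)
  renaming (zero to fzero; suc to fsuc; _<_ to _<ᶠ_)
import Data.Fin.Properties as Fin
open import Data.Fin.Properties
  using (_≟_; any?; all?; ¬∀⟶∃¬; combine-remQuot; toℕ-injective; injective⇒≤; nonZeroIndex)
open import Data.Fin.Subset using (Subset; ∣_∣; _-_; ⁅_⁆; ⊤) renaming (_∈_ to _∈ₛ_)
open import Data.Fin.Subset.Properties
  using (nonempty?; ∈⊤; x∈p∧x≢y⇒x∈p-y; x∈p⇒∣p-x∣<∣p∣; ∣p─q∣≤∣p∣) renaming (_∈?_ to _∈ₛ?_)
open import Data.List
  using (List; []; _∷_; _++_; [_]; _∷ʳ_; length; lookup; map; filter; allFin; tabulate; reverse; _ʳ++_)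
open import Data.List.Properties
  using (length-++; length-++-sucʳ; length-++-≤ˡ; ++-assoc; ∷-injective; ∷-injectiveˡ; length-ʳ++; ʳ++-defn;
         unfold-reverse; ∷ʳ-injectiveʳ; map-tabulate; length-tabulate)
open import Data.List.Membership.Propositional using (_∈_; _∉_; find)
open import Data.List.Membership.Propositional.Properties using (∈-lookup; ∈-++⁺ʳ; ∈-allFin; ∈-filter⁺)
open import Data.List.Membership.Setoid.Properties using (index-injective)
open import Data.List.Relation.Unary.All using (All; []; _∷_)
import Data.List.Relation.Unary.All as All
open import Data.List.Relation.Unary.All.Properties using (++⁻ˡ; ¬Any⇒All¬; All¬⇒¬Any; ¬All⇒Any¬)
open import Data.List.Relation.Unary.AllPairs using (AllPairs; []; _∷_)
open import Data.List.Relation.Unary.Any using (here; there)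
import Data.List.Relation.Unary.Any as Any
open import Data.List.Relation.Unary.Any.Properties using (lookup-index)
open import Data.List.Relation.Unary.Linked using (Linked; []; [-]; _∷_)
import Data.List.Relation.Unary.Linked as Linked
open import Data.List.Relation.Unary.Unique.Propositional using (Unique)
open import Data.Maybe using (Maybe; just; nothing)
import Data.Maybe.Properties as Maybe
open import Data.Nat
  using (ℕ; zero; suc; _+_; _*_; _^_; _%_; _≤_; _<_; _≤′_; ≤′-refl; ≤′-step; _<?_; _≤?_; _<ᵇ_; z≤n; s≤s; NonZero)
open import Data.Nat.Induction using (<-wellFounded)
open import Data.Nat.ListAction using (sum)
import Data.Nat.Properties as ℕ
open import Data.Nat.Properties
  using (module ≤-Reasoning; ≤-refl; ≤-trans; ≤-reflexive; ≤-pred; ≤-antisym; ≤⇒≤′; <⇒≱; ≮⇒≥; <-asym;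
         <-≤-trans; ≤-<-trans; n≤1+n; m≤n⇒m≤1+n; m≤n⇒m<n∨m≡n; m≤m+n; m≤n+m; m≤m*n; suc-injective;
         +-comm; +-suc; +-identityʳ; +-mono-≤; +-monoˡ-≤; +-monoʳ-≤; +-cancelʳ-≡; *-assoc; *-distribʳ-+;
         *-monoˡ-≤; *-monoʳ-≤; *-monoˡ-<; *-cancelˡ-≤; ^-distribˡ-+-*; m^n≢0; <ᵇ⇒<; <⇒<ᵇ)
open import Data.Nat.Solver using (module +-*-Solver)
open import Algebra.Properties.CommutativeMonoid.Sum ℕ.+-0-commutativeMonoid
  using (sum-syntax; ∑-distrib-+; ∑-comm; sum-cong-≗)
open import Data.Product using (Σ; ∃; ∃₂; ∃-syntax; _×_; _,_; proj₁; proj₂; uncurry)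
open import Data.Sum using (_⊎_; inj₁; inj₂; [_,_]′)
import Data.Sum as Sum
open import Data.Unit using (tt)
open import Data.Vec.Functional using (updateAt)
open import Data.Vec.Functional.Properties using (updateAt-updates; updateAt-minimal)
open import Function using (_∘_; _∘′_; _on_; const; id)
open import Function.Bundles using (mk⇔)
open import Function.Definitions using (Injective)
open import Induction.WellFounded using (Acc; acc)
open import Relation.Binary using (tri<; tri≈; tri>; Symmetric)
open import Relation.Binary.Construct.On using (wellFounded)
open import Relation.Binary.Definitions using (DecidableEquality)
open import Relation.Binary.PropositionalEquality
  using (_≡_; _≢_; refl; sym; trans; cong; cong₂; subst; subst₂; setoid; module ≡-Reasoning)
open import Relation.Nullary using (¬_; Dec; yes; no; does; contradiction; ¬?; _×-dec_; _⊎-dec_; _→-dec_)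
open import Relation.Nullary.Decidable using (T?; map′; from-yes; dec-true; dec-false; does-⇔; decidable-stable)
open +-*-Solver using (solve; _:+_; _:*_; con; _:=_)

refute-implication : ∀ {A B C : Set} → Dec A → Dec B → ¬ (A → B → C) → A × B × ¬ C
refute-implication (yes a) (yes b) ¬f = a , b , λ c → ¬f λ _ _ → c
refute-implication (yes _) (no ¬b) ¬f = contradiction (λ _ b → contradiction b ¬b) ¬f
refute-implication (no ¬a) _       ¬f = contradiction (λ a → contradiction a ¬a) ¬f

from-does : ∀ {A : Set} (a? : Dec A) → does a? ≡ true → A
from-does (yes a) _ = a

least-Fin : ∀ {m} {P : Fin m → Set} → (∀ i → Dec (P i)) →
            (∃ λ i → P i × ∀ {j} → j <ᶠ i → ¬ P j) ⊎ (∀ i → ¬ P i)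
least-Fin {zero}  P? = inj₂ λ ()
least-Fin {suc m} P? with P? fzero | least-Fin (P? ∘ fsuc)
... | yes p₀ | _                     = inj₁ (fzero , p₀ , λ ())
... | no ¬p₀ | inj₁ (i , pᵢ , lower) = inj₁ (fsuc i , pᵢ , λ { {fzero} _ → ¬p₀ ; {fsuc j} (s≤s j<i) → lower j<i })
... | no ¬p₀ | inj₂ none             = inj₂ λ { fzero → ¬p₀ ; (fsuc i) → none i }

least-≤ : ∀ {P : ℕ → Set} → (∀ d → Dec (P d)) → ∀ M →
          (∃ λ d → d ≤ M × P d × ∀ {d′} → d′ < d → ¬ P d′) ⊎ (∀ {d} → d ≤ M → ¬ P d)
least-≤ P? zero with P? 0
... | yes p₀ = inj₁ (0 , z≤n , p₀ , λ ())
... | no ¬p₀ = inj₂ λ { z≤n → ¬p₀ }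
least-≤ P? (suc M) with least-≤ P? M | P? (suc M)
... | inj₁ (d , d≤M , p , lower) | _     = inj₁ (d , m≤n⇒m≤1+n d≤M , p , lower)
... | inj₂ none                  | yes p = inj₁ (suc M , ≤-refl , p , none ∘ ≤-pred)
... | inj₂ none                  | no ¬p = inj₂ λ d≤1+M →
  [ none ∘ ≤-pred , (λ { refl → ¬p }) ]′ (m≤n⇒m<n∨m≡n d≤1+M)

∣p-x-y-z∣<∣p∣ : ∀ {m} {p : Subset m} {x} y z → x ∈ₛ p → ∣ p - x - y - z ∣ < ∣ p ∣
∣p-x-y-z∣<∣p∣ {p = p} {x} y z x∈p =
  ≤-<-trans (∣p─q∣≤∣p∣ (p - x - y) ⁅ z ⁆) (≤-<-trans (∣p─q∣≤∣p∣ (p - x) ⁅ y ⁆) (x∈p⇒∣p-x∣<∣p∣ x∈p))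

update₃ : ∀ {A : Set} {m} (φ : Fin m → A) {a b c} → a ≢ b → a ≢ c → b ≢ c → ∀ x y z →
          Σ (Fin m → A) λ ψ → ψ a ≡ x × ψ b ≡ y × ψ c ≡ z × (∀ {w} → w ≢ a → w ≢ b → w ≢ c → ψ w ≡ φ w)
update₃ φ {a} {b} {c} a≢b a≢c b≢c x y z =
  ψ ,
  trans (updateAt-minimal a c _ a≢c) (trans (updateAt-minimal a b _ a≢b) (updateAt-updates a φ)) ,
  trans (updateAt-minimal b c _ b≢c) (updateAt-updates b _) ,
  updateAt-updates c _ ,
  λ {w} w≢a w≢b w≢c →
    trans (updateAt-minimal w c _ w≢c) (trans (updateAt-minimal w b _ w≢b) (updateAt-minimal w a φ w≢a))
  where
  ψ = updateAt (updateAt (updateAt φ a (const x)) b (const y)) c (const z)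

module _ {A : Set} {R : A → A → Set} (R-sym : Symmetric R) where

  AllPairs-lookup : ∀ {xs} → AllPairs R xs → ∀ {i j} → i ≢ j → R (lookup xs i) (lookup xs j)
  AllPairs-lookup {_ ∷ _} _         {fzero}  {fzero}  i≢j = contradiction refl i≢j
  AllPairs-lookup {_ ∷ _} (Rx ∷ _)  {fzero}  {fsuc j} _   = All.lookup Rx (∈-lookup j)
  AllPairs-lookup {_ ∷ _} (Rx ∷ _)  {fsuc i} {fzero}  _   = R-sym (All.lookup Rx (∈-lookup i))
  AllPairs-lookup {_ ∷ _} (_ ∷ Rxs) {fsuc i} {fsuc j} i≢j = AllPairs-lookup Rxs (i≢j ∘ cong fsuc)

module _ {A : Set} where

  Unique-++⁻ˡ : ∀ (xs : List A) {ys} → Unique (xs ++ ys) → Unique xs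
  Unique-++⁻ˡ []       _          = []
  Unique-++⁻ˡ (x ∷ xs) (x∉ ∷ xs!) = ++⁻ˡ xs x∉ ∷ Unique-++⁻ˡ xs xs!

  lookup-injective : ∀ {xs : List A} → Unique xs → Injective _≡_ _≡_ (lookup xs)
  lookup-injective {_ ∷ _} _         {fzero}  {fzero}  _  = refl
  lookup-injective {_ ∷ _} (x∉ ∷ _)  {fzero}  {fsuc j} eq = contradiction eq (All.lookup x∉ (∈-lookup j))
  lookup-injective {_ ∷ _} (x∉ ∷ _)  {fsuc i} {fzero}  eq = contradiction (sym eq) (All.lookup x∉ (∈-lookup i))
  lookup-injective {_ ∷ _} (_ ∷ xs!) {fsuc i} {fsuc j} eq = cong fsuc (lookup-injective xs! eq)

  first-occurrence : DecidableEquality A → ∀ {x} ys → x ∈ ys →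
                     ∃₂ λ pre post → ys ≡ pre ++ x ∷ post × x ∉ pre
  first-occurrence _≟ₐ_ {x} (y ∷ ys) x∈ with x ≟ₐ y | x∈
  ... | yes refl | _           = [] , ys , refl , λ ()
  ... | no x≢y   | here x≡y    = contradiction x≡y x≢y
  ... | no x≢y   | there x∈ys with first-occurrence _≟ₐ_ ys x∈ys
  ...   | pre , post , refl , x∉pre =
    y ∷ pre , post , refl , λ { (here x≡y) → x≢y x≡y ; (there x∈pre) → x∉pre x∈pre }

  All-ʳ++ : ∀ {P : A → Set} xs {zs} → All P xs → All P zs → All P (xs ʳ++ zs)
  All-ʳ++ []       _          pzs = pzs
  All-ʳ++ (_ ∷ xs) (px ∷ pxs) pzs = All-ʳ++ xs pxs (px ∷ pzs)

  ++-injective : ∀ (xs ys : List A) {zs ws} → length xs ≡ length ys →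
                 xs ++ zs ≡ ys ++ ws → xs ≡ ys × zs ≡ ws
  ++-injective []       []       _   eq = refl , eq
  ++-injective (x ∷ xs) (y ∷ ys) len eq with ∷-injective eq
  ... | refl , eq′ with ++-injective xs ys (suc-injective len) eq′
  ...   | refl , refl = refl , refl

  split-at-first-unique : ∀ {P : A → Set} (xs ys : List A) {x y xs′ ys′} →
                          All (¬_ ∘′ P) xs → All (¬_ ∘′ P) ys → P x → P y →
                          xs ++ x ∷ xs′ ≡ ys ++ y ∷ ys′ → xs ≡ ys × x ∷ xs′ ≡ y ∷ ys′
  split-at-first-unique []       []       _           _           _  _  eq = refl , eq
  split-at-first-unique []       (_ ∷ _)  _           (¬Py′ ∷ _)  Px _  eq with refl ← ∷-injectiveˡ eq =
    contradiction Px ¬Py′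
  split-at-first-unique (_ ∷ _)  []       (¬Px′ ∷ _)  _           _  Py eq with refl ← ∷-injectiveˡ eq =
    contradiction Py ¬Px′
  split-at-first-unique (_ ∷ xs) (_ ∷ ys) (_ ∷ ¬Pxs) (_ ∷ ¬Pys) Px Py eq with ∷-injective eq
  ... | refl , eq′ with split-at-first-unique xs ys ¬Pxs ¬Pys Px Py eq′
  ...   | refl , eq″ = refl , eq″

-- Non-backtracking walks and girth

module Walks (G : Graph) where

  Vertex : Set
  Vertex = Fin (n G)

  Adj-sym : ∀ {u v} → Adj G u v → Adj G v u
  Adj-sym {u} {v} uv = trans (adj-sym G v u) uv

  Adj-irrefl : ∀ {u} → ¬ Adj G u u
  Adj-irrefl {u} uu = contradiction (trans (sym uu) (adj-irr G u)) λ ()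

  Adj⇒≢ : ∀ {u v} → Adj G u v → u ≢ v
  Adj⇒≢ uv refl = Adj-irrefl uv

  IsWalk : List Vertex → Set
  IsWalk = Linked (Adj G)

  data NonBacktracking : List Vertex → Set where
    []    : NonBacktracking []
    [-]   : ∀ {x} → NonBacktracking (x ∷ [])
    [-,-] : ∀ {x y} → NonBacktracking (x ∷ y ∷ [])
    _∷_   : ∀ {x y z xs} → x ≢ z → NonBacktracking (y ∷ z ∷ xs) → NonBacktracking (x ∷ y ∷ z ∷ xs)

  NonBacktracking-tail : ∀ {x xs} → NonBacktracking (x ∷ xs) → NonBacktracking xs
  NonBacktracking-tail [-]      = []
  NonBacktracking-tail [-,-]    = [-]
  NonBacktracking-tail (_ ∷ nb) = nb

  data EndsAt (c : Vertex) : List Vertex → Set where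
    ends-here  : EndsAt c (c ∷ [])
    ends-later : ∀ {x xs} → EndsAt c xs → EndsAt c (x ∷ xs)

  EndsAt⇒∈ : ∀ {c xs} → EndsAt c xs → c ∈ xs
  EndsAt⇒∈ ends-here      = here refl
  EndsAt⇒∈ (ends-later e) = there (EndsAt⇒∈ e)

  EndsAt-[_] : ∀ {c} x → EndsAt c (x ∷ []) → x ≡ c
  EndsAt-[ _ ] ends-here = refl

  EndsAt-tail : ∀ {c x y xs} → EndsAt c (x ∷ y ∷ xs) → EndsAt c (y ∷ xs)
  EndsAt-tail (ends-later e) = e

  -- Walks are listed backwards: the head is the current end and the list ends at the start c.
  IsNBWalkTo : Vertex → List Vertex → Set
  IsNBWalkTo c xs = IsWalk xs × NonBacktracking xs × EndsAt c xs

  IsNBWalkTo-tail : ∀ {c x y xs} → IsNBWalkTo c (x ∷ y ∷ xs) → IsNBWalkTo c (y ∷ xs)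
  IsNBWalkTo-tail (_ ∷ w , nb , e) = w , NonBacktracking-tail nb , EndsAt-tail e

  ʳ++-IsWalk : ∀ {z} xs {zs} → IsWalk (z ∷ xs) → IsWalk (z ∷ zs) → IsWalk ((z ∷ xs) ʳ++ zs)
  ʳ++-IsWalk []       _        w′ = w′
  ʳ++-IsWalk (_ ∷ xs) (zx ∷ w) w′ = ʳ++-IsWalk xs w (Adj-sym zx ∷ w′)

  ʳ++-NonBacktracking : ∀ {p z} xs {zs} → NonBacktracking (p ∷ z ∷ xs) → NonBacktracking (z ∷ p ∷ zs) →
                        NonBacktracking ((z ∷ xs) ʳ++ p ∷ zs)
  ʳ++-NonBacktracking []       _           nb′ = nb′
  ʳ++-NonBacktracking (_ ∷ xs) (p≢x ∷ nb) nb′ = ʳ++-NonBacktracking xs nb ((p≢x ∘′ sym) ∷ nb′)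

  ʳ++-preserves-EndsAt : ∀ {c} xs {zs} → EndsAt c zs → EndsAt c (xs ʳ++ zs)
  ʳ++-preserves-EndsAt []       e = e
  ʳ++-preserves-EndsAt (_ ∷ xs) e = ʳ++-preserves-EndsAt xs (ends-later e)

  ʳ++-head : ∀ {c} xs {zs} → EndsAt c xs → ∃ λ pre → xs ʳ++ zs ≡ c ∷ pre ++ zs
  ʳ++-head _ ends-here = [] , refl
  ʳ++-head {c} (x ∷ xs) {zs} (ends-later e) with ʳ++-head xs {x ∷ zs} e
  ... | pre , eq = pre ++ [ x ] , trans eq (cong (c ∷_) (sym (++-assoc pre [ x ] zs)))

  lookup-adjacent : ∀ {x z} ys → IsWalk (x ∷ ys ++ [ z ]) → (i : Fin (length ys)) →
                    Adj G (lookup (x ∷ ys) (inject₁ i)) (lookup (x ∷ ys) (fsuc i))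
  lookup-adjacent (_ ∷ _)  (xy ∷ _) fzero    = xy
  lookup-adjacent (_ ∷ ys) (_ ∷ w)  (fsuc i) = lookup-adjacent ys w i

  lookup-last-adjacent : ∀ {x z} ys → IsWalk (x ∷ ys ++ [ z ]) → Adj G (lookup (x ∷ ys) (fromℕ (length ys))) z
  lookup-last-adjacent []       (xz ∷ _) = xz
  lookup-last-adjacent (_ ∷ ys) (_ ∷ w)  = lookup-last-adjacent ys w

  closedWalk⇒Cycle : ∀ {a b c} rest → Unique (a ∷ b ∷ c ∷ rest) → IsWalk (a ∷ b ∷ c ∷ rest ++ [ a ]) →
                     Cycle G (length rest)
  closedWalk⇒Cycle {a} {b} {c} rest uniq w = record
    { f      = lookup (a ∷ b ∷ c ∷ rest)
    ; inj    = lookup-injective uniq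
    ; consec = lookup-adjacent (b ∷ c ∷ rest) w
    ; close  = lookup-last-adjacent (b ∷ c ∷ rest) w
    }

  IsWalk-prefix : ∀ xs {y ys} → IsWalk (xs ++ y ∷ ys) → IsWalk (xs ++ [ y ])
  IsWalk-prefix []            _         = [-]
  IsWalk-prefix (_ ∷ [])      (xy ∷ _)  = xy ∷ [-]
  IsWalk-prefix (_ ∷ x′ ∷ xs) (xx′ ∷ w) = xx′ ∷ IsWalk-prefix (x′ ∷ xs) w

  module Girth {g : ℕ} (girth : GirthAtLeast g G) where

    head∉unique-tail : ∀ {x} ys → IsWalk (x ∷ ys) → NonBacktracking (x ∷ ys) → length (x ∷ ys) ≤ g →
                       Unique ys → x ∉ ys
    -- The first return to x closes a cycle shorter than the walk.
    head∉unique-tail {x} ys w nb len ys! x∈ys with first-occurrence _≟_ ys x∈ys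
    ... | [] , _ , refl , _ = Adj-irrefl (Linked.head w)
    ... | _ ∷ [] , _ , refl , _ with nb
    ...   | x≢x ∷ _ = x≢x refl
    head∉unique-tail {x} ys w nb len ys! x∈ys | p ∷ q ∷ pre , post , refl , x∉pre =
      <⇒≱ (<-≤-trans cycle<walk len) (girth (length pre) cycle)
      where
      cycle : Cycle G (length pre)
      cycle = closedWalk⇒Cycle pre (¬Any⇒All¬ _ x∉pre ∷ Unique-++⁻ˡ (p ∷ q ∷ pre) ys!)
                (IsWalk-prefix (x ∷ p ∷ q ∷ pre) w)
      cycle<walk : 3 + length pre < length (x ∷ ys)
      cycle<walk = s≤s (s≤s (s≤s (≤-trans (s≤s (length-++-≤ˡ pre)) (≤-reflexive (sym (length-++-sucʳ pre x post))))))

    nonBacktracking⇒Unique : ∀ xs → IsWalk xs → NonBacktracking xs → length xs ≤ g → Unique xs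
    nonBacktracking⇒Unique []       _ _  _   = []
    nonBacktracking⇒Unique (_ ∷ ys) w nb len = ¬Any⇒All¬ ys (head∉unique-tail ys w nb len ys!) ∷ ys!
      where
      ys! = nonBacktracking⇒Unique ys (Linked.tail w) (NonBacktracking-tail nb) (≤-trans (n≤1+n _) len)

    head∉tail : ∀ {x} ys → IsWalk (x ∷ ys) → NonBacktracking (x ∷ ys) → length (x ∷ ys) ≤ g → x ∉ ys
    head∉tail ys w nb len with nonBacktracking⇒Unique _ w nb len
    ... | x∉ ∷ _ = All¬⇒¬Any x∉

    triangle-free : 4 ≤ g → ∀ {a b c} → Adj G a b → Adj G b c → ¬ Adj G c a
    triangle-free 4≤g ab bc ca =
      head∉tail _ (ab ∷ bc ∷ ca ∷ [-]) (Adj⇒≢ (Adj-sym ca) ∷ Adj⇒≢ (Adj-sym ab) ∷ [-,-]) 4≤g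
        (there (there (here refl)))

    nonBacktracking-walk-unique : ∀ {c y} A B → IsNBWalkTo c (y ∷ A) → IsNBWalkTo c (y ∷ B) →
                                  length (y ∷ A) + length (y ∷ B) ≤ suc g → A ≡ B
    nonBacktracking-walk-unique []      []      _ _ _ = refl
    nonBacktracking-walk-unique {y = y} [] (b ∷ B) (_ , _ , eA) (wB , nbB , eB) len with EndsAt-[ y ] eA
    ... | refl = contradiction (EndsAt⇒∈ (EndsAt-tail eB)) (head∉tail (b ∷ B) wB nbB (≤-pred len))
    nonBacktracking-walk-unique {y = y} (a ∷ A) [] (wA , nbA , eA) (_ , _ , eB) len with EndsAt-[ y ] eB
    ... | refl = contradiction (EndsAt⇒∈ (EndsAt-tail eA))
                   (head∉tail (a ∷ A) wA nbA (≤-pred (≤-trans (≤-reflexive (+-comm 1 _)) len)))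
    nonBacktracking-walk-unique {c} {y} (a ∷ A) (b ∷ B) WA@(ya ∷ wA , nbA , eA) WB@(yb ∷ wB , nbB , eB) len
      with a ≟ b
    ... | yes refl = cong (a ∷_) (nonBacktracking-walk-unique A B (IsNBWalkTo-tail WA) (IsNBWalkTo-tail WB)
                       (≤-trans (+-mono-≤ (n≤1+n (length (a ∷ A))) (n≤1+n (length (a ∷ B)))) len))
    -- Otherwise A reversed, then y, then B is a non-backtracking closed walk at c shorter than the girth.
    ... | no a≢b with ʳ++-head (a ∷ A) {y ∷ b ∷ B} (EndsAt-tail eA)
    ...   | pre , eq = contradiction (∈-++⁺ʳ pre (there (EndsAt⇒∈ (EndsAt-tail eB))))
                         (head∉tail (pre ++ y ∷ b ∷ B) (subst IsWalk eq walk) (subst NonBacktracking eq nb)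
                            (subst (λ xs → length xs ≤ g) eq walk-length))
      where
      walk : IsWalk ((a ∷ A) ʳ++ y ∷ b ∷ B)
      walk = ʳ++-IsWalk A wA (Adj-sym ya ∷ yb ∷ wB)
      nb : NonBacktracking ((a ∷ A) ʳ++ y ∷ b ∷ B)
      nb = ʳ++-NonBacktracking A nbA (a≢b ∷ nbB)
      walk-length : length ((a ∷ A) ʳ++ y ∷ b ∷ B) ≤ g
      walk-length = ≤-trans (≤-reflexive (length-ʳ++ (a ∷ A))) (≤-pred len)

-- Walks inside a vertex set, Voronoi cells and the shallow minor they span

module Reachability (G : Graph) (S : Subset (n G)) where
  open Walks G

  Reach : ℕ → Vertex → Vertex → Set
  Reach zero    c v = c ∈ₛ S × c ≡ v
  Reach (suc k) c v = Reach k c v ⊎ (v ∈ₛ S × ∃ λ u → Reach k c u × Adj G u v)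

  reach? : ∀ k c v → Dec (Reach k c v)
  reach? zero    c v = (c ∈ₛ? S) ×-dec (c ≟ v)
  reach? (suc k) c v = reach? k c v ⊎-dec ((v ∈ₛ? S) ×-dec any? λ u → reach? k c u ×-dec (adj G u v Bool.≟ true))

  Reach-mono : ∀ {k k′ c v} → k ≤ k′ → Reach k c v → Reach k′ c v
  Reach-mono = mono ∘ ≤⇒≤′
    where
    mono : ∀ {k k′ c v} → k ≤′ k′ → Reach k c v → Reach k′ c v
    mono ≤′-refl       r = r
    mono (≤′-step le) r = inj₁ (mono le r)

  Reach-∷ : ∀ k {u v c} → v ∈ₛ S → Adj G v u → Reach k u c → Reach (suc k) v c
  Reach-∷ zero    v∈ vu (u∈ , refl)          = inj₂ (u∈ , _ , (v∈ , refl) , vu)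
  Reach-∷ (suc k) v∈ vu (inj₁ r)             = inj₁ (Reach-∷ k v∈ vu r)
  Reach-∷ (suc k) v∈ vu (inj₂ (c∈ , w , r , wc)) = inj₂ (c∈ , w , Reach-∷ k v∈ vu r , wc)

  Reach-sym : ∀ k {c v} → Reach k c v → Reach k v c
  Reach-sym zero    (c∈ , refl)             = c∈ , refl
  Reach-sym (suc k) (inj₁ r)                = inj₁ (Reach-sym k r)
  Reach-sym (suc k) (inj₂ (v∈ , u , r , uv)) = Reach-∷ k v∈ (Adj-sym uv) (Reach-sym k r)

  Reach-trans : ∀ {a} b {x w v} → Reach a x w → Reach b w v → Reach (b + a) x v
  Reach-trans zero    r (_ , refl)               = r
  Reach-trans (suc b) r (inj₁ r′)                = inj₁ (Reach-trans b r r′)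
  Reach-trans (suc b) r (inj₂ (v∈ , u , r′ , uv)) = inj₂ (v∈ , u , Reach-trans b r r′ , uv)

  record Walk (c v : Vertex) : Set where
    constructor walk
    field
      trail   : List Vertex
      isWalk  : IsNBWalkTo c (v ∷ trail)
      inside  : All (_∈ₛ S) (v ∷ trail)

  open Walk public

  steps : ∀ {c v} → Walk c v → ℕ
  steps W = length (trail W)

  Walk⇒Reach : ∀ {c v} (W : Walk c v) → Reach (steps W) c v
  Walk⇒Reach {c} (walk t W ins) = go t W ins
    where
    go : ∀ {v} t → IsNBWalkTo c (v ∷ t) → All (_∈ₛ S) (v ∷ t) → Reach (length t) c v
    go []      (_ , _ , e)         (v∈ ∷ []) with EndsAt-[ _ ] e
    ... | refl = v∈ , refl
    go (u ∷ t) W@(vu ∷ _ , _ , _) (v∈ ∷ ins) = inj₂ (v∈ , u , go t (IsNBWalkTo-tail W) ins , Adj-sym vu)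

  Walk-reaches : ∀ {c v} (W : Walk c v) → All (λ w → Reach (steps W) c w) (v ∷ trail W)
  Walk-reaches {c} (walk t W ins) = go t W ins
    where
    go : ∀ {v} t → IsNBWalkTo c (v ∷ t) → All (_∈ₛ S) (v ∷ t) → All (λ w → Reach (length t) c w) (v ∷ t)
    go []      W ins = Walk⇒Reach (walk [] W ins) ∷ []
    go (u ∷ t) W ins@(_ ∷ ins′) = Walk⇒Reach (walk (u ∷ t) W ins) ∷ All.map inj₁ (go t (IsNBWalkTo-tail W) ins′)

  Walk⇒WalkIn : ∀ {P : Vertex → Set} {c v} (W : Walk c v) → All P (v ∷ trail W) → WalkIn G P c v (steps W)
  Walk⇒WalkIn (walk [] (_ , _ , e) _) (p ∷ []) with EndsAt-[ _ ] e
  ... | refl = stay p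
  Walk⇒WalkIn {P} (walk (u ∷ t) (vu ∷ w , nb , ends-later e) (_ ∷ ins)) (pv ∷ ps) =
    snoc (Walk⇒WalkIn (walk t (w , NonBacktracking-tail nb , e) ins) ps) (Adj-sym vu) pv
    where
    snoc : ∀ {s x y k} → WalkIn G P s x k → Adj G x y → P y → WalkIn G P s y (suc k)
    snoc (stay px)      xy py = step px xy (stay py)
    snoc (step px xz w) zy py = step px xz (snoc w zy py)

module Voronoi (G : Graph) (S : Subset (n G)) (M : ℕ) (X : List (Fin (n G))) where
  open Walks G
  open Reachability G S

  K : ℕ
  K = length X

  centre : Fin K → Vertex
  centre = lookup X

  -- Centre i is the one nearest to v within distance M, ties broken by index.
  record Nearest (v : Vertex) (d : ℕ) (i : Fin K) : Set where
    field
      reaches   : Reach d (centre i) v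
      within    : d ≤ M
      no-closer : ∀ {d′} i′ → d′ < d → ¬ Reach d′ (centre i′) v
      no-lower  : ∀ {i′} → i′ <ᶠ i → ¬ Reach d (centre i′) v

  open Nearest

  Nearest-unique : ∀ {v d i d′ i′} → Nearest v d i → Nearest v d′ i′ → d ≡ d′ × i ≡ i′
  Nearest-unique {d = d} {i} {d′} {i′} p q with ℕ.<-cmp d d′
  ... | tri< d<d′ _ _ = contradiction (reaches p) (no-closer q i d<d′)
  ... | tri> _ _ d′<d = contradiction (reaches q) (no-closer p i′ d′<d)
  ... | tri≈ _ refl _ with Fin.<-cmp i i′
  ...   | tri< i<i′ _ _ = contradiction (reaches p) (no-lower q i<i′)
  ...   | tri> _ _ i′<i = contradiction (reaches q) (no-lower p i′<i)
  ...   | tri≈ _ refl _ = refl , refl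

  nearest? : ∀ v → (∃₂ (Nearest v)) ⊎ (∀ {d} i → d ≤ M → ¬ Reach d (centre i) v)
  nearest? v with least-≤ (λ d → any? λ i → reach? d (centre i) v) M
  ... | inj₂ none = inj₂ λ i d≤M r → none d≤M (i , r)
  ... | inj₁ (d , d≤M , (i₀ , r₀) , closer) with least-Fin (λ i → reach? d (centre i) v)
  ...   | inj₂ none            = contradiction r₀ (none i₀)
  ...   | inj₁ (i , r , lower) = inj₁ (d , i , record
          { reaches = r ; within = d≤M ; no-closer = λ i′ d′<d r′ → closer d′<d (i′ , r′) ; no-lower = lower })

  cell : Vertex → Maybe (Fin K)
  cell v with nearest? v
  ... | inj₁ (_ , i , _) = just i
  ... | inj₂ _           = nothing

  InCell : Fin K → Vertex → Set
  InCell i v = cell v ≡ just i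

  Nearest⇒InCell : ∀ {v d i} → Nearest v d i → InCell i v
  Nearest⇒InCell {v} p with nearest? v
  ... | inj₁ (_ , _ , q) = cong just (proj₂ (Nearest-unique q p))
  ... | inj₂ none        = contradiction (reaches p) (none _ (within p))

  Reach⇒Nearest : ∀ {d i v} → d ≤ M → Reach d (centre i) v → ∃₂ (Nearest v)
  Reach⇒Nearest {i = i} {v} d≤M r with nearest? v
  ... | inj₁ p    = p
  ... | inj₂ none = contradiction r (none i d≤M)

  InCell⇒Nearest : ∀ {v i} → InCell i v → ∃ λ d → Nearest v d i
  InCell⇒Nearest {v} eq with nearest? v | eq
  ... | inj₁ (d , _ , p) | refl = d , p
  ... | inj₂ _           | ()

  Nearest-pred : ∀ {u v d i} → Nearest v (suc d) i → v ∈ₛ S → Adj G u v → Reach d (centre i) u → Nearest u d i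
  Nearest-pred p v∈ uv r = record
    { reaches   = r
    ; within    = ≤-trans (n≤1+n _) (within p)
    ; no-closer = λ i′ d′<d r′ → no-closer p i′ (s≤s d′<d) (inj₂ (v∈ , _ , r′ , uv))
    ; no-lower  = λ i′<i r′ → no-lower p i′<i (inj₂ (v∈ , _ , r′ , uv))
    }

  shortest-walk : ∀ d {v i} → Nearest v d i → Σ (Walk (centre i) v) λ W → steps W ≡ d × All (InCell i) (v ∷ trail W)
  shortest-walk zero p with reaches p
  ... | c∈ , refl = walk [] ([-] , [-] , ends-here) (c∈ ∷ []) , refl , Nearest⇒InCell p ∷ []
  shortest-walk (suc d) p with reaches p
  ... | inj₁ r = contradiction r (no-closer p _ ≤-refl)
  ... | inj₂ (v∈ , u , r , uv) with shortest-walk d (Nearest-pred p v∈ uv r)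
  ...   | walk [] (lk , _ , e) ins , refl , cells =
          walk (u ∷ []) (Adj-sym uv ∷ lk , [-,-] , ends-later e) (v∈ ∷ ins) , refl , Nearest⇒InCell p ∷ cells
  ...   | walk (w ∷ t) (lk , nb , e) ins , refl , cells =
          walk (u ∷ w ∷ t) (Adj-sym uv ∷ lk , v≢w ∷ nb , ends-later e) (v∈ ∷ ins) , refl , Nearest⇒InCell p ∷ cells
    where
    v≢w : _ ≢ w
    v≢w refl = no-closer p _ (n≤1+n _) (Walk⇒Reach (walk t (IsNBWalkTo-tail (lk , nb , e)) (All.tail ins)))

  Covering : Set
  Covering = ∀ {v} → v ∈ₛ S → ∃ λ i → Reach M (centre i) v

  Covering⇒InCell : Covering → ∀ {v} → v ∈ₛ S → ∃ λ i → InCell i v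
  Covering⇒InCell cover v∈ with Reach⇒Nearest ≤-refl (proj₂ (cover v∈))
  ... | _ , i , p = i , Nearest⇒InCell p

  Separated : Set
  Separated = ∀ {i j} → i ≢ j → ¬ Reach M (centre i) (centre j)

  module WellPlaced (separated : Separated) (centre∈S : ∀ i → centre i ∈ₛ S) where

    centre-InCell : ∀ i → InCell i (centre i)
    centre-InCell i = Nearest⇒InCell record
      { reaches   = centre∈S i , refl
      ; within    = z≤n
      ; no-closer = λ _ ()
      ; no-lower  = λ i′<i r → separated (Fin.<⇒≢ i′<i) (Reach-mono z≤n r)
      }

    ball⊆cell : ∀ {L i w} → L + L ≤ M → Reach L (centre i) w → InCell i w
    ball⊆cell {L} {i} {w} 2L≤M r with Reach⇒Nearest (≤-trans (m≤m+n L L) 2L≤M) r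
    ... | d , i′ , p with i′ ≟ i
    ...   | yes refl = Nearest⇒InCell p
    ...   | no i′≢i  = contradiction (Reach-mono (≤-trans (+-mono-≤ (≤-refl {L}) d≤L) 2L≤M)
                                       (Reach-trans L (reaches p) (Reach-sym L r)))
                                     (separated i′≢i)
      where
      d≤L : d ≤ L
      d≤L = ≮⇒≥ λ L<d → no-closer p i L<d r

  Touching : Fin K → Fin K → Set
  Touching i j = i ≢ j × ∃₂ λ u v → InCell i u × InCell j v × Adj G u v

  touching? : ∀ i j → Dec (Touching i j)
  touching? i j = ¬? (i ≟ j) ×-dec any? λ u → any? λ v →
    Maybe.≡-dec _≟_ (cell u) (just i) ×-dec Maybe.≡-dec _≟_ (cell v) (just j) ×-dec adj G u v Bool.≟ true

  Touching-sym : ∀ {i j} → Touching i j → Touching j i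
  Touching-sym (i≢j , u , v , iu , jv , uv) = i≢j ∘ sym , v , u , jv , iu , Adj-sym uv

  cellGraph : Graph
  cellGraph = record
    { n       = K
    ; adj     = λ i j → does (touching? i j)
    ; adj-sym = λ i j → does-⇔ (mk⇔ Touching-sym Touching-sym) (touching? i j) (touching? j i)
    ; adj-irr = λ i → dec-false (touching? i i) λ (i≢i , _) → i≢i refl
    }

  cellGraph-minor : Separated → (∀ i → centre i ∈ₛ S) → ShallowMinor M cellGraph G
  cellGraph-minor separated centre∈S = record
    { β       = cell
    ; centre  = centre
    ; centre∈ = WellPlaced.centre-InCell separated centre∈S
    ; radius  = radius
    ; edges   = λ i j ij → proj₂ (from-does (touching? i j) ij)
    }
    where
    radius : ∀ i v → InCell i v → ∃ λ k → k ≤ M × WalkIn G (InCell i) (centre i) v k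
    radius i v v∈i with InCell⇒Nearest v∈i
    ... | d , p with shortest-walk d p
    ...   | W , refl , cells = steps W , within p , Walk⇒WalkIn W cells

module Centres (G : Graph) (S : Subset (n G)) (M : ℕ) where
  open Walks G
  open Reachability G S

  Far : Vertex → Vertex → Set
  Far x y = ¬ Reach M x y

  Far-sym : Symmetric Far
  Far-sym far r = far (Reach-sym M r)

  admissible? : ∀ chosen v → Dec (v ∈ₛ S × All (λ x → Far x v) chosen)
  admissible? chosen v = (v ∈ₛ? S) ×-dec All.all? (λ x → ¬? (reach? M x v)) chosen

  greedy : List Vertex → List Vertex → List Vertex
  greedy chosen []       = chosen
  greedy chosen (v ∷ vs) with admissible? chosen v
  ... | yes _ = greedy (v ∷ chosen) vs
  ... | no  _ = greedy chosen vs

  greedy-⊇ : ∀ chosen vs {x} → x ∈ chosen → x ∈ greedy chosen vs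
  greedy-⊇ chosen []       x∈ = x∈
  greedy-⊇ chosen (v ∷ vs) x∈ with admissible? chosen v
  ... | yes _ = greedy-⊇ (v ∷ chosen) vs (there x∈)
  ... | no  _ = greedy-⊇ chosen vs x∈

  greedy-separated : ∀ chosen vs → AllPairs Far chosen → All (_∈ₛ S) chosen →
                     AllPairs Far (greedy chosen vs) × All (_∈ₛ S) (greedy chosen vs)
  greedy-separated chosen []       seps ins = seps , ins
  greedy-separated chosen (v ∷ vs) seps ins with admissible? chosen v
  ... | yes (v∈ , far) = greedy-separated (v ∷ chosen) vs (All.map Far-sym far ∷ seps) (v∈ ∷ ins)
  ... | no  _          = greedy-separated chosen vs seps ins

  greedy-covers : ∀ chosen vs {v} → v ∈ vs → v ∈ₛ S → ∃ λ x → x ∈ greedy chosen vs × Reach M x v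
  greedy-covers chosen (w ∷ vs) v∈vs v∈ with admissible? chosen w | v∈vs
  ... | yes _ | there v∈vs′ = greedy-covers (w ∷ chosen) vs v∈vs′ v∈
  ... | no  _ | there v∈vs′ = greedy-covers chosen vs v∈vs′ v∈
  ... | yes _ | here refl   = w , greedy-⊇ (w ∷ chosen) vs (here refl) , Reach-mono z≤n (v∈ , refl)
  ... | no ¬adm | here refl with find (¬All⇒Any¬ (λ x → ¬? (reach? M x w)) chosen λ far → ¬adm (v∈ , far))
  ...   | x , x∈ , ¬far = x , greedy-⊇ chosen vs x∈ , decidable-stable (reach? M x w) ¬far

  centres : List Vertex
  centres = greedy [] (allFin (n G))

  open Voronoi G S M centres

  centres-separated : Separated
  centres-separated = AllPairs-lookup Far-sym (proj₁ (greedy-separated [] (allFin (n G)) [] []))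

  centre∈S : ∀ i → centre i ∈ₛ S
  centre∈S i = All.lookup (proj₂ (greedy-separated [] (allFin (n G)) [] [])) (∈-lookup i)

  centres-cover : Covering
  centres-cover {v} v∈ with greedy-covers [] (allFin (n G)) (∈-allFin v) v∈
  ... | x , x∈ , r = Any.index x∈ , subst (λ c → Reach M c v) (lookup-index x∈) r

-- Reducible configurations, and branching of walks in their absence

module Configurations (G : Graph) (S : Subset (n G)) where
  open Walks G

  OnlyNeighbours : Vertex → Vertex → Vertex → Set
  OnlyNeighbours x p q = ∀ w → w ∈ₛ S → Adj G x w → w ≡ p ⊎ w ≡ q

  only? : ∀ x p q → Dec (OnlyNeighbours x p q)
  only? x p q = all? λ w → (w ∈ₛ? S) →-dec (adj G x w Bool.≟ true) →-dec ((w ≟ p) ⊎-dec (w ≟ q))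

  record TwoNeighbours (x : Vertex) : Set where
    constructor twoNeighbours
    field
      {p q} : Vertex
      p∈S   : p ∈ₛ S
      q∈S   : q ∈ₛ S
      xp    : Adj G x p
      xq    : Adj G x q
      p≢q   : p ≢ q

  another-neighbour : ∀ {x} → TwoNeighbours x → ∀ y → ∃ λ z → z ∈ₛ S × Adj G x z × z ≢ y
  another-neighbour (twoNeighbours {p} {q} p∈ q∈ xp xq p≢q) y with p ≟ y
  ... | yes refl = q , q∈ , xq , p≢q ∘ sym
  ... | no p≢y   = p , p∈ , xp , p≢y

  AtMostOneNeighbour : Vertex → Set
  AtMostOneNeighbour v = ∃ λ z → ∀ w → w ∈ₛ S → Adj G v w → w ≡ z

  atMostOneNeighbour? : ∀ v → Dec (AtMostOneNeighbour v)
  atMostOneNeighbour? v = any? λ z → all? λ w → (w ∈ₛ? S) →-dec (adj G v w Bool.≟ true) →-dec (w ≟ z)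

  ¬AtMostOne⇒another-neighbour : ∀ {v} → ¬ AtMostOneNeighbour v → ∀ z → ∃ λ w → w ∈ₛ S × Adj G v w × w ≢ z
  ¬AtMostOne⇒another-neighbour {v} ¬at-most-one z
    with ¬∀⟶∃¬ _ _ (λ w → (w ∈ₛ? S) →-dec (adj G v w Bool.≟ true) →-dec (w ≟ z))
                   (λ only-z → ¬at-most-one (z , only-z))
  ... | w , ¬only-z = w , refute-implication (w ∈ₛ? S) (adj G v w Bool.≟ true) ¬only-z

  ¬AtMostOne⇒TwoNeighbours : ∀ {v} → ¬ AtMostOneNeighbour v → TwoNeighbours v
  ¬AtMostOne⇒TwoNeighbours {v} ¬at-most-one with ¬AtMostOne⇒another-neighbour ¬at-most-one v
  ... | p , p∈ , vp , _ with ¬AtMostOne⇒another-neighbour ¬at-most-one p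
  ...   | q , q∈ , vq , q≢p = twoNeighbours p∈ q∈ vp vq (q≢p ∘ sym)

  record Thread (u a b c v : Vertex) : Set where
    field
      a∈S    : a ∈ₛ S
      b∈S    : b ∈ₛ S
      c∈S    : c ∈ₛ S
      ua     : Adj G u a
      ab     : Adj G a b
      bc     : Adj G b c
      cv     : Adj G c v
      u≢b    : u ≢ b
      a≢c    : a ≢ c
      b≢v    : b ≢ v
      only-a : OnlyNeighbours a u b
      only-b : OnlyNeighbours b a c
      only-c : OnlyNeighbours c b v

  thread? : ∀ u a b c v → Dec (Thread u a b c v)
  thread? u a b c v = map′
    (λ (a∈S , b∈S , c∈S , ua , ab , bc , cv , u≢b , a≢c , b≢v , only-a , only-b , only-c) → record
      { a∈S = a∈S ; b∈S = b∈S ; c∈S = c∈S ; ua = ua ; ab = ab ; bc = bc ; cv = cv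
      ; u≢b = u≢b ; a≢c = a≢c ; b≢v = b≢v ; only-a = only-a ; only-b = only-b ; only-c = only-c })
    (λ t → let open Thread t in
      a∈S , b∈S , c∈S , ua , ab , bc , cv , u≢b , a≢c , b≢v , only-a , only-b , only-c)
    ((a ∈ₛ? S) ×-dec (b ∈ₛ? S) ×-dec (c ∈ₛ? S) ×-dec
     (adj G u a Bool.≟ true) ×-dec (adj G a b Bool.≟ true) ×-dec
     (adj G b c Bool.≟ true) ×-dec (adj G c v Bool.≟ true) ×-dec
     ¬? (u ≟ b) ×-dec ¬? (a ≟ c) ×-dec ¬? (b ≟ v) ×-dec
     only? a u b ×-dec only? b a c ×-dec only? c b v)

  record DenseCore : Set where
    field
      nonempty   : ∃ (_∈ₛ S)
      min-degree : ∀ {x} → x ∈ₛ S → TwoNeighbours x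
      no-thread  : ∀ {u a b c v} → ¬ Thread u a b c v

module Branching (G : Graph) (S : Subset (n G)) where
  open Walks G
  open Reachability G S using (Walk; walk)
  open Configurations G S

  record Fork (x y : Vertex) : Set where
    field
      branch           : Fin 2 → Vertex
      branch∈S         : ∀ b → branch b ∈ₛ S
      adjacent         : ∀ b → Adj G x (branch b)
      branch≢          : ∀ b → branch b ≢ y
      branch-injective : ∀ {b b′} → branch b ≡ branch b′ → b ≡ b′

  fork : ∀ {x y p q} → p ∈ₛ S → q ∈ₛ S → Adj G x p → Adj G x q → p ≢ y → q ≢ y → p ≢ q → Fork x y
  fork {p = p} {q} p∈ q∈ xp xq p≢y q≢y p≢q = record
    { branch           = λ { fzero → p ; (fsuc _) → q }
    ; branch∈S         = λ { fzero → p∈ ; (fsuc fzero) → q∈ }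
    ; adjacent         = λ { fzero → xp ; (fsuc fzero) → xq }
    ; branch≢          = λ { fzero → p≢y ; (fsuc fzero) → q≢y }
    ; branch-injective = λ { {fzero} {fzero} _ → refl ; {fsuc fzero} {fsuc fzero} _ → refl
                           ; {fzero} {fsuc fzero} p≡q → contradiction p≡q p≢q
                           ; {fsuc fzero} {fzero} q≡p → contradiction (sym q≡p) p≢q }
    }

  record Continuation (x y : Vertex) : Set where
    constructor continuation
    field
      {z} : Vertex
      z∈S : z ∈ₛ S
      xz  : Adj G x z
      z≢y : z ≢ y
      only : OnlyNeighbours x y z

  fork-or-continuation : ∀ {x y} → y ∈ₛ S → Adj G x y → TwoNeighbours x → Fork x y ⊎ Continuation x y
  fork-or-continuation {x} {y} y∈ xy (twoNeighbours {p} {q} p∈ q∈ xp xq p≢q)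
    with any? (λ w → (w ∈ₛ? S) ×-dec (adj G x w Bool.≟ true) ×-dec ¬? (w ≟ p) ×-dec ¬? (w ≟ q))
  ... | yes (w , w∈ , xw , w≢p , w≢q) = inj₁ (two-of-three (p ≟ y) (q ≟ y))
    where
    two-of-three : Dec (p ≡ y) → Dec (q ≡ y) → Fork x y
    two-of-three (yes refl) _          = fork q∈ w∈ xq xw (p≢q ∘ sym) w≢p (w≢q ∘ sym)
    two-of-three (no p≢y)   (yes refl) = fork p∈ w∈ xp xw p≢y w≢q (w≢p ∘ sym)
    two-of-three (no p≢y)   (no q≢y)   = fork p∈ q∈ xp xq p≢y q≢y p≢q
  ... | no ∄w = inj₂ (the-other (only y y∈ xy))
    where
    only : OnlyNeighbours x p q
    only w w∈ xw with w ≟ p | w ≟ q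
    ... | yes w≡p | _       = inj₁ w≡p
    ... | no _    | yes w≡q = inj₂ w≡q
    ... | no w≢p  | no w≢q  = contradiction (w , w∈ , xw , w≢p , w≢q) ∄w
    the-other : y ≡ p ⊎ y ≡ q → Continuation x y
    the-other (inj₁ refl) = continuation q∈ xq (p≢q ∘ sym) only
    the-other (inj₂ refl) = continuation p∈ xp p≢q λ w w∈ xw → Sum.swap (only w w∈ xw)

  record NBWalk (c : Vertex) : Set where
    constructor nbWalk
    field
      tip prev : Vertex
      rest     : List Vertex
      isWalk   : IsNBWalkTo c (tip ∷ prev ∷ rest)
      inside   : All (_∈ₛ S) (tip ∷ prev ∷ rest)

  module _ {c : Vertex} where
    open NBWalk

    vertices : NBWalk c → List Vertex
    vertices W = tip W ∷ prev W ∷ rest W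

    tip∈S : (W : NBWalk c) → tip W ∈ₛ S
    tip∈S (nbWalk _ _ _ _ (x∈ ∷ _)) = x∈

    prev∈S : (W : NBWalk c) → prev W ∈ₛ S
    prev∈S (nbWalk _ _ _ _ (_ ∷ y∈ ∷ _)) = y∈

    tip-prev : (W : NBWalk c) → Adj G (tip W) (prev W)
    tip-prev (nbWalk _ _ _ (xy ∷ _ , _) _) = xy

    toWalk : (W : NBWalk c) → Walk c (tip W)
    toWalk (nbWalk _ y r W ins) = walk (y ∷ r) W ins

    extend : (W : NBWalk c) → ∀ {z} → z ∈ₛ S → Adj G (tip W) z → z ≢ prev W → NBWalk c
    extend (nbWalk x y r (lk , nb , e) ins) {z} z∈ xz z≢y =
      nbWalk z x (y ∷ r) (Adj-sym xz ∷ lk , z≢y ∷ nb , ends-later e) (z∈ ∷ ins)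

  record Bifurcation {c : Vertex} (W : NBWalk c) : Set where
    field
      next            : Fin 2 → NBWalk c
      added           : Fin 2 → List Vertex
      next≡           : ∀ b → vertices (next b) ≡ added b ++ vertices W
      length-added    : ∀ b → length (added b) ≡ 3
      added-injective : ∀ {b b′} → added b ≡ added b′ → b ≡ b′

  module Trees (core : DenseCore) {c : Vertex} (c∈S : c ∈ₛ S) where
    open DenseCore core
    open NBWalk
    open ≡-Reasoning

    forward : NBWalk c → NBWalk c
    forward W = extend-by (another-neighbour (min-degree (tip∈S W)) (prev W))
      where
      extend-by : (∃ λ z → z ∈ₛ S × Adj G (tip W) z × z ≢ prev W) → NBWalk c
      extend-by (_ , z∈ , xz , z≢y) = extend W z∈ xz z≢y

    forward^ : ℕ → NBWalk c → NBWalk c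
    forward^ zero    W = W
    forward^ (suc k) W = forward (forward^ k W)

    forward^-vertices : ∀ k W → ∃ λ F → vertices (forward^ k W) ≡ F ++ vertices W × length F ≡ k
    forward^-vertices zero    W = [] , refl , refl
    forward^-vertices (suc k) W with forward^-vertices k W
    ... | F , eq , len = tip (forward (forward^ k W)) ∷ F , cong (tip (forward (forward^ k W)) ∷_) eq , cong suc len

    bifurcate-after : (W W′ : NBWalk c) (E : List Vertex) → vertices W′ ≡ E ++ vertices W →
                      Fork (tip W′) (prev W′) → ∀ k → k + length E ≡ 2 → Bifurcation W
    bifurcate-after W W′ E W′≡ f k k+E≡2 = record
      { next            = next
      ; added           = added
      ; next≡           = next≡
      ; length-added    = length-added
      ; added-injective = added-injective
      }
      where
      open Fork f
      first : Fin 2 → NBWalk c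
      first b = extend W′ (branch∈S b) (adjacent b) (branch≢ b)
      next : Fin 2 → NBWalk c
      next b = forward^ k (first b)
      F : Fin 2 → List Vertex
      F b = proj₁ (forward^-vertices k (first b))
      length-F : ∀ b → length (F b) ≡ k
      length-F b = proj₂ (proj₂ (forward^-vertices k (first b)))
      added : Fin 2 → List Vertex
      added b = F b ++ branch b ∷ E
      next≡ : ∀ b → vertices (next b) ≡ added b ++ vertices W
      next≡ b = begin
        vertices (next b)                 ≡⟨ proj₁ (proj₂ (forward^-vertices k (first b))) ⟩
        F b ++ branch b ∷ vertices W′     ≡⟨ cong (λ vs → F b ++ branch b ∷ vs) W′≡ ⟩
        F b ++ branch b ∷ E ++ vertices W ≡⟨ ++-assoc (F b) (branch b ∷ E) (vertices W) ⟨
        added b ++ vertices W             ∎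
      length-added : ∀ b → length (added b) ≡ 3
      length-added b = begin
        length (F b ++ branch b ∷ E)  ≡⟨ length-++ (F b) ⟩
        length (F b) + suc (length E) ≡⟨ cong (_+ suc (length E)) (length-F b) ⟩
        k + suc (length E)            ≡⟨ +-suc k (length E) ⟩
        suc (k + length E)            ≡⟨ cong suc k+E≡2 ⟩
        3                             ∎
      added-injective : ∀ {b b′} → added b ≡ added b′ → b ≡ b′
      added-injective {b} {b′} eq = branch-injective (∷-injectiveˡ (proj₂
        (++-injective (F b) (F b′) (trans (length-F b) (sym (length-F b′))) eq)))

    -- Without a thread, one of the next three vertices along W has two onward neighbours in S.
    bifurcate : (W : NBWalk c) → Bifurcation W
    bifurcate W with fork-or-continuation (prev∈S W) (tip-prev W) (min-degree (tip∈S W))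
    ... | inj₁ f = bifurcate-after W W [] refl f 2 refl
    ... | inj₂ (continuation {x₂} x₂∈ x₁x₂ x₂≢x₀ only₁)
      with fork-or-continuation (tip∈S W) (Adj-sym x₁x₂) (min-degree x₂∈)
    ...   | inj₁ f = bifurcate-after W (extend W x₂∈ x₁x₂ x₂≢x₀) (x₂ ∷ []) refl f 1 refl
    ...   | inj₂ (continuation {x₃} x₃∈ x₂x₃ x₃≢x₁ only₂)
      with fork-or-continuation x₂∈ (Adj-sym x₂x₃) (min-degree x₃∈)
    ...     | inj₁ f =
              bifurcate-after W (extend (extend W x₂∈ x₁x₂ x₂≢x₀) x₃∈ x₂x₃ x₃≢x₁) (x₃ ∷ x₂ ∷ []) refl f 0 refl
    ...     | inj₂ (continuation x₄∈ x₃x₄ x₄≢x₂ only₃) = ⊥-elim (no-thread record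
              { a∈S = tip∈S W ; b∈S = x₂∈ ; c∈S = x₃∈
              ; ua = Adj-sym (tip-prev W) ; ab = x₁x₂ ; bc = x₂x₃ ; cv = x₃x₄
              ; u≢b = x₂≢x₀ ∘ sym ; a≢c = x₃≢x₁ ∘ sym ; b≢v = x₄≢x₂ ∘ sym
              ; only-a = only₁ ; only-b = only₂ ; only-c = only₃
              })

    start : NBWalk c
    start = nbWalk p c [] (Adj-sym xp ∷ [-] , [-,-] , ends-later ends-here) (p∈S ∷ c∈S ∷ [])
      where open TwoNeighbours (min-degree c∈S)

    tree : ∀ t → Fin (2 ^ t) → NBWalk c
    grow : ∀ t → Fin 2 × Fin (2 ^ t) → NBWalk c

    tree zero    _ = start
    tree (suc t) i = grow t (remQuot (2 ^ t) i)

    grow t (b , i) = Bifurcation.next (bifurcate (tree t i)) b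

    tree-length : ∀ t i → length (vertices (tree t i)) ≡ 2 + t * 3
    grow-length : ∀ t p → length (vertices (grow t p)) ≡ 2 + suc t * 3

    tree-length zero    _ = refl
    tree-length (suc t) i = grow-length t (remQuot (2 ^ t) i)

    grow-length t (b , i) = begin
      length (vertices (next b))                      ≡⟨ cong length (next≡ b) ⟩
      length (added b ++ vertices (tree t i))         ≡⟨ length-++ (added b) ⟩
      length (added b) + length (vertices (tree t i)) ≡⟨ cong₂ _+_ (length-added b) (tree-length t i) ⟩
      3 + (2 + t * 3)                                 ∎
      where open Bifurcation (bifurcate (tree t i))

    tree-injective : ∀ t {i i′} → vertices (tree t i) ≡ vertices (tree t i′) → i ≡ i′
    grow-injective : ∀ t {p p′} → vertices (grow t p) ≡ vertices (grow t p′) → p ≡ p′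

    tree-injective zero    {fzero} {fzero} _ = refl
    tree-injective (suc t) {i} {i′} eq = begin
      i                                     ≡⟨ combine-remQuot {2} (2 ^ t) i ⟨
      uncurry combine (remQuot (2 ^ t) i)  ≡⟨ cong (uncurry combine) (grow-injective t eq) ⟩
      uncurry combine (remQuot (2 ^ t) i′) ≡⟨ combine-remQuot {2} (2 ^ t) i′ ⟩
      i′                                    ∎

    grow-injective t {b , i} {b′ , i′} eq
      with ++-injective (B.added b) (B′.added b′) (trans (B.length-added b) (sym (B′.length-added b′)))
                        (trans (sym (B.next≡ b)) (trans eq (B′.next≡ b′)))
      where
      module B  = Bifurcation (bifurcate (tree t i))
      module B′ = Bifurcation (bifurcate (tree t i′))
    ... | added≡ , vertices≡ with tree-injective t vertices≡
    ...   | refl = cong (_, i) (Bifurcation.added-injective (bifurcate (tree t i)) added≡)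

-- Every cell touches 2^j other cells

module Exits (G : Graph) (S : Subset (n G)) {g : ℕ} (girth : GirthAtLeast g G) (M : ℕ) (X : List (Fin (n G))) where
  open Walks G
  open Girth girth
  open Reachability G S
  open Voronoi G S M X
  open Configurations G S
  open Branching G S

  module FromCentre (separated : Separated) (centre∈S : ∀ i → centre i ∈ₛ S) (cover : Covering)
                    (core : DenseCore) (L j : ℕ) (L+L≤M : L + L ≤ M) (depth≤L : suc (j * 3) ≤ L)
                    (girth-large : (M + (M + (2 + j * 3))) + (M + (M + (2 + j * 3))) ≤ suc g)
                    (i₀ : Fin K) where
    open WellPlaced separated centre∈S
    open Trees core (centre∈S i₀)
    open NBWalk

    c₀ : Vertex
    c₀ = centre i₀

    InCell₀ : Vertex → Set
    InCell₀ = InCell i₀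

    ExitLength DetourLength : ℕ
    ExitLength   = M + (2 + j * 3)
    DetourLength = M + ExitLength

    tree-in-cell : ∀ b → All InCell₀ (vertices (tree j b))
    tree-in-cell b = All.map (ball⊆cell L+L≤M ∘ Reach-mono steps≤L) (Walk-reaches (toWalk (tree j b)))
      where
      steps≤L : length (prev (tree j b) ∷ rest (tree j b)) ≤ L
      steps≤L = ≤-trans (≤-reflexive (suc-injective (tree-length j b))) depth≤L

    record Exit (f : ℕ) (W : NBWalk c₀) : Set where
      field
        exit        : NBWalk c₀
        prefix      : List Vertex
        exit≡       : vertices exit ≡ prefix ++ vertices W
        prefix≤     : length prefix ≤ f
        tip-outside : ¬ InCell₀ (tip exit)
        rest-inside : All InCell₀ (prev exit ∷ rest exit)

    escape : ∀ f (W : NBWalk c₀) → All InCell₀ (prev W ∷ rest W) →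
             Exit f W ⊎ Σ (NBWalk c₀) λ W′ → InCell₀ (tip W′) × f + length (vertices W) ≡ length (vertices W′)
    escape f W inside₀ with Maybe.≡-dec _≟_ (cell (tip W)) (just i₀)
    ... | no out = inj₁ record
      { exit = W ; prefix = [] ; exit≡ = refl ; prefix≤ = z≤n ; tip-outside = out ; rest-inside = inside₀ }
    escape zero    W inside₀ | yes in₀ = inj₂ (W , in₀ , refl)
    escape (suc f) W inside₀ | yes in₀ with escape f (forward W) (in₀ ∷ inside₀)
    ... | inj₂ (W′ , in′ , len) = inj₂ (W′ , in′ , trans (sym (+-suc f _)) len)
    ... | inj₁ e = inj₁ record
      { exit        = exit
      ; prefix      = prefix ++ [ z ]
      ; exit≡       = trans exit≡ (sym (++-assoc prefix [ z ] (vertices W)))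
      ; prefix≤     = ≤-trans (≤-reflexive (trans (length-++ prefix) (+-comm _ 1))) (s≤s prefix≤)
      ; tip-outside = tip-outside
      ; rest-inside = rest-inside
      }
      where
      open Exit e
      z = tip (forward W)

    no-long-walk : (W : NBWalk c₀) → InCell₀ (tip W) → suc M < length (vertices W) →
                   length (vertices W) + suc M ≤ suc g → ⊥
    -- The shortest walk from c₀ to the tip has at most M edges, so by the girth bound it would be W itself.
    no-long-walk W in₀ long short with InCell⇒Nearest in₀
    ... | d , p with shortest-walk d p
    ...   | P , refl , _ = <⇒≱ long (s≤s (≤-trans (≤-reflexive (cong length same)) (Nearest.within p)))
      where
      same : prev W ∷ rest W ≡ trail P
      same = nonBacktracking-walk-unique (prev W ∷ rest W) (trail P) (isWalk W) (Walk.isWalk P)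
               (≤-trans (+-monoʳ-≤ (length (vertices W)) (s≤s (Nearest.within p))) short)

    exit-bound : ExitLength + suc M ≤ DetourLength + DetourLength
    exit-bound = +-mono-≤ (m≤n+m ExitLength M)
                   (≤-trans (≤-reflexive (+-comm 1 M)) (+-monoʳ-≤ M (≤-trans (s≤s z≤n) (m≤n+m (2 + j * 3) M))))

    tree-exit : ∀ b → Exit M (tree j b)
    tree-exit b with escape M (tree j b) (All.tail (tree-in-cell b))
    ... | inj₁ e = e
    ... | inj₂ (W′ , in′ , len) = ⊥-elim (no-long-walk W′ in′ long (≤-trans (+-monoˡ-≤ (suc M) (≤-reflexive len′))
                                                                  (≤-trans exit-bound girth-large)))
      where
      len′ : length (vertices W′) ≡ ExitLength
      len′ = trans (sym len) (cong (M +_) (tree-length j b))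
      long : suc M < length (vertices W′)
      long = ≤-trans (s≤s (s≤s (m≤m+n M (j * 3))))
               (≤-reflexive (sym (trans len′ (trans (+-suc M _) (cong suc (+-suc M _))))))

    exit-walk : Fin (2 ^ j) → NBWalk c₀
    exit-walk b = Exit.exit (tree-exit b)

    exit-length : ∀ b → length (vertices (exit-walk b)) ≤ ExitLength
    exit-length b = ≤-trans (≤-reflexive (trans (cong length exit≡) (length-++ prefix)))
                      (+-mono-≤ prefix≤ (≤-reflexive (tree-length j b)))
      where open Exit (tree-exit b)

    exit-cell : Fin (2 ^ j) → Fin K
    exit-cell b = proj₁ (Covering⇒InCell cover (tip∈S (exit-walk b)))

    exit-in-cell : ∀ b → InCell (exit-cell b) (tip (exit-walk b))
    exit-in-cell b = proj₂ (Covering⇒InCell cover (tip∈S (exit-walk b)))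

    exit-touching : ∀ b → Touching i₀ (exit-cell b)
    exit-touching b =
      (λ i₀≡ → tip-outside (subst (λ i → InCell i (tip (exit-walk b))) (sym i₀≡) (exit-in-cell b))) ,
      prev (exit-walk b) , tip (exit-walk b) , All.head rest-inside , exit-in-cell b ,
      Adj-sym (tip-prev (exit-walk b))
      where open Exit (tree-exit b)

    record Detour (W : NBWalk c₀) (i₁ : Fin K) : Set where
      field
        outside     : List Vertex
        outside-tip : ∃ λ init → outside ≡ init ∷ʳ tip W
        outside∉    : All (¬_ ∘ InCell₀) outside
        prev-inside : InCell₀ (prev W)
        from-centre : ∃ λ tail → outside ++ prev W ∷ rest W ≡ centre i₁ ∷ tail
        is-walk     : IsNBWalkTo c₀ (outside ++ prev W ∷ rest W)
        length≤     : length (outside ++ prev W ∷ rest W) ≤ M + length (vertices W)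

    detour : (W : NBWalk c₀) → ¬ InCell₀ (tip W) → All InCell₀ (prev W ∷ rest W) →
             ∀ {i₁} → InCell i₁ (tip W) → Detour W i₁
    detour W out inside₀ {i₁} in₁ with InCell⇒Nearest in₁
    ... | d , p with shortest-walk d p
    ...   | P , refl , cells = record
      { outside     = reverse (tip W ∷ trail P)
      ; outside-tip = reverse (trail P) , unfold-reverse (tip W) (trail P)
      ; outside∉    = All-ʳ++ (tip W ∷ trail P) (All.map outside-cell₀ cells) []
      ; prev-inside = All.head inside₀
      ; from-centre = from-centre
      ; is-walk     = subst (IsNBWalkTo c₀) (ʳ++-defn (tip W ∷ trail P))
                        ( ʳ++-IsWalk (trail P) (proj₁ (Walk.isWalk P)) (proj₁ (isWalk W))
                        , ʳ++-NonBacktracking (trail P) (turn (trail P) (proj₁ (proj₂ (Walk.isWalk P))) cells)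
                            (proj₁ (proj₂ (isWalk W)))
                        , ʳ++-preserves-EndsAt (tip W ∷ trail P) (EndsAt-tail (proj₂ (proj₂ (isWalk W)))))
      ; length≤     = ≤-trans (≤-reflexive (trans (cong length (sym (ʳ++-defn (tip W ∷ trail P))))
                                             (trans (length-ʳ++ (tip W ∷ trail P)) (sym (+-suc (steps P) _)))))
                              (+-monoˡ-≤ _ (Nearest.within p))
      }
      where
      outside-cell₀ : ∀ {v} → InCell i₁ v → ¬ InCell₀ v
      outside-cell₀ v∈i₁ v∈i₀ = out (trans in₁ (trans (sym v∈i₁) v∈i₀))
      turn : ∀ t → NonBacktracking (tip W ∷ t) → All (InCell i₁) (tip W ∷ t) → NonBacktracking (prev W ∷ tip W ∷ t)
      turn []      _  _              = [-,-]
      turn (w ∷ t) nb (_ ∷ w∈i₁ ∷ _) = (λ prev≡w → outside-cell₀ w∈i₁ (subst InCell₀ prev≡w (All.head inside₀))) ∷ nb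
      from-centre : ∃ λ tail → reverse (tip W ∷ trail P) ++ prev W ∷ rest W ≡ centre i₁ ∷ tail
      from-centre with ʳ++-head (tip W ∷ trail P) {prev W ∷ rest W} (proj₂ (proj₂ (Walk.isWalk P)))
      ... | pre , eq = pre ++ prev W ∷ rest W , trans (sym (ʳ++-defn (tip W ∷ trail P))) eq

    -- Both detours are non-backtracking walks from c₀ to centre i₁ within the girth bound, hence equal,
    -- and the exits are their parts from the first vertex outside cell i₀ onwards.
    detours-agree : ∀ {W₁ W₂ i₁} → Detour W₁ i₁ → Detour W₂ i₁ →
                    length (vertices W₁) ≤ ExitLength → length (vertices W₂) ≤ ExitLength → vertices W₁ ≡ vertices W₂
    detours-agree {W₁} {W₂} {i₁} D₁ D₂ len₁ len₂
      with Detour.from-centre D₁ | Detour.from-centre D₂ | Detour.is-walk D₁ | Detour.is-walk D₂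
    ... | T₁ , eq₁ | T₂ , eq₂ | walk₁ | walk₂ with
      split-at-first-unique (Detour.outside D₁) (Detour.outside D₂) (Detour.outside∉ D₁) (Detour.outside∉ D₂)
        (Detour.prev-inside D₁) (Detour.prev-inside D₂) (trans eq₁ (trans (cong (centre i₁ ∷_) same-tail) (sym eq₂)))
      where
      bound : ∀ {W} (D : Detour W i₁) → length (vertices W) ≤ ExitLength →
              length (Detour.outside D ++ prev W ∷ rest W) ≤ DetourLength
      bound D len = ≤-trans (Detour.length≤ D) (+-monoʳ-≤ M len)
      same-tail : T₁ ≡ T₂
      same-tail = nonBacktracking-walk-unique T₁ T₂
                    (subst (IsNBWalkTo c₀) eq₁ walk₁) (subst (IsNBWalkTo c₀) eq₂ walk₂)
                    (≤-trans (+-mono-≤ (subst (λ xs → length xs ≤ DetourLength) eq₁ (bound D₁ len₁))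
                                       (subst (λ xs → length xs ≤ DetourLength) eq₂ (bound D₂ len₂)))
                             girth-large)
    ... | outside≡ , rest≡ with Detour.outside-tip D₁ | Detour.outside-tip D₂
    ...   | init₁ , tip₁ | init₂ , tip₂ =
            cong₂ _∷_ (∷ʳ-injectiveʳ init₁ init₂ (trans (sym tip₁) (trans outside≡ tip₂))) rest≡

    exit-cell-injective : ∀ {b b′} → exit-cell b ≡ exit-cell b′ → b ≡ b′
    exit-cell-injective {b} {b′} eq =
      tree-injective j (proj₂ (++-injective F F′ prefix-lengths prefixed))
      where
      E  = tree-exit b
      E′ = tree-exit b′
      F  = Exit.prefix E
      F′ = Exit.prefix E′
      same : vertices (exit-walk b) ≡ vertices (exit-walk b′)
      same = detours-agree
        (detour (exit-walk b) (Exit.tip-outside E) (Exit.rest-inside E) (exit-in-cell b))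
        (detour (exit-walk b′) (Exit.tip-outside E′) (Exit.rest-inside E′)
           (subst (λ i → InCell i (tip (exit-walk b′))) (sym eq) (exit-in-cell b′)))
        (exit-length b) (exit-length b′)
      prefixed : F ++ vertices (tree j b) ≡ F′ ++ vertices (tree j b′)
      prefixed = trans (sym (Exit.exit≡ E)) (trans same (Exit.exit≡ E′))
      prefix-lengths : length F ≡ length F′
      prefix-lengths = +-cancelʳ-≡ (2 + j * 3) _ _ (begin
        length F + (2 + j * 3)                    ≡⟨ cong (length F +_) (tree-length j b) ⟨
        length F + length (vertices (tree j b))   ≡⟨ length-++ F ⟨
        length (F ++ vertices (tree j b))         ≡⟨ cong length prefixed ⟩
        length (F′ ++ vertices (tree j b′))       ≡⟨ length-++ F′ ⟩
        length F′ + length (vertices (tree j b′)) ≡⟨ cong (length F′ +_) (tree-length j b′) ⟩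
        length F′ + (2 + j * 3)                   ∎)
        where open ≡-Reasoning

-- Counting edges

indicator : Bool → ℕ
indicator b = if b then 1 else 0

count : ∀ {m} → (Fin m → Bool) → ℕ
count {m} P = sum (map (indicator ∘ P) (allFin m))

sum-indicator≡length-filter : ∀ {A : Set} (P : A → Bool) xs →
                              sum (map (indicator ∘ P) xs) ≡ length (filter (T? ∘ P) xs)
sum-indicator≡length-filter P []       = refl
sum-indicator≡length-filter P (x ∷ xs) with P x
... | true  = cong suc (sum-indicator≡length-filter P xs)
... | false = sum-indicator≡length-filter P xs

injective⇒≤-count : ∀ {k m} (P : Fin m → Bool) (e : Fin k → Fin m) → Injective _≡_ _≡_ e →
                    (∀ i → P (e i) ≡ true) → k ≤ count P
injective⇒≤-count {k} {m} P e e-injective Pe =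
  subst (k ≤_) (sym (sum-indicator≡length-filter P (allFin m))) (injective⇒≤ position-injective)
  where
  member : ∀ i → e i ∈ filter (T? ∘ P) (allFin m)
  member i = ∈-filter⁺ (T? ∘ P) (∈-allFin (e i)) (subst T (sym (Pe i)) tt)
  position-injective : Injective _≡_ _≡_ (Any.index ∘ member)
  position-injective eq = e-injective (index-injective (setoid (Fin m)) (member _) (member _) eq)

<ᵇ-true : ∀ m n → (m <ᵇ n) ≡ true → m < n
<ᵇ-true m n eq = <ᵇ⇒< m n (subst T (sym eq) tt)

<ᵇ-false : ∀ m n → (m <ᵇ n) ≡ false → ¬ m < n
<ᵇ-false m n eq = subst T eq ∘ <⇒<ᵇ

sum-≥ : ∀ {A : Set} (f : A → ℕ) {c} xs → (∀ x → c ≤ f x) → length xs * c ≤ sum (map f xs)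
sum-≥ f []       _   = z≤n
sum-≥ f (x ∷ xs) c≤f = +-mono-≤ (c≤f x) (sum-≥ f xs c≤f)

sum-allFin : ∀ {m} (f : Fin m → ℕ) → sum (map f (allFin m)) ≡ ∑[ i < m ] f i
sum-allFin f = trans (cong sum (map-tabulate id f)) (sum-tabulate f)
  where
  sum-tabulate : ∀ {m} (f : Fin m → ℕ) → sum (tabulate f) ≡ ∑[ i < m ] f i
  sum-tabulate {zero}  f = refl
  sum-tabulate {suc m} f = cong (f fzero +_) (sum-tabulate (f ∘ fsuc))

module Handshake (G : Graph) where
  open ≡-Reasoning

  degree : Fin (n G) → ℕ
  degree u = count (adj G u)

  forward-edge : Fin (n G) → Fin (n G) → ℕ
  forward-edge u v = indicator ((toℕ u <ᵇ toℕ v) ∧ adj G u v)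

  indicator-adj : ∀ u v → indicator (adj G u v) ≡ forward-edge u v + forward-edge v u
  indicator-adj u v with toℕ u <ᵇ toℕ v in u<v | toℕ v <ᵇ toℕ u in v<u
  ... | true  | true  = contradiction (<ᵇ-true (toℕ u) (toℕ v) u<v) (<-asym (<ᵇ-true (toℕ v) (toℕ u) v<u))
  ... | true  | false = sym (+-identityʳ _)
  ... | false | true  = cong indicator (adj-sym G u v)
  ... | false | false with toℕ-injective {i = u} {j = v} (≤-antisym (≮⇒≥ (<ᵇ-false (toℕ v) (toℕ u) v<u))
                                                                  (≮⇒≥ (<ᵇ-false (toℕ u) (toℕ v) u<v)))
  ...   | refl = cong indicator (adj-irr G u)

  edgeCount≡ : edgeCount G ≡ ∑[ u < n G ] ∑[ v < n G ] forward-edge u v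
  edgeCount≡ = trans (sum-allFin (λ u → sum (map (forward-edge u) (allFin (n G)))))
                     (sum-cong-≗ λ u → sum-allFin (forward-edge u))

  handshake : sum (map degree (allFin (n G))) ≡ edgeCount G + edgeCount G
  handshake = begin
    sum (map degree (allFin (n G)))
      ≡⟨ sum-allFin degree ⟩
    ∑[ u < n G ] degree u
      ≡⟨ sum-cong-≗ (λ u → trans (sum-allFin (indicator ∘ adj G u)) (sum-cong-≗ (indicator-adj u))) ⟩
    ∑[ u < n G ] ∑[ v < n G ] (forward-edge u v + forward-edge v u)
      ≡⟨ sum-cong-≗ (λ u → ∑-distrib-+ (forward-edge u) (λ v → forward-edge v u)) ⟩
    ∑[ u < n G ] (∑[ v < n G ] forward-edge u v + ∑[ v < n G ] forward-edge v u)
      ≡⟨ ∑-distrib-+ (λ u → ∑[ v < n G ] forward-edge u v) (λ u → ∑[ v < n G ] forward-edge v u) ⟩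
    ∑[ u < n G ] ∑[ v < n G ] forward-edge u v + ∑[ u < n G ] ∑[ v < n G ] forward-edge v u
      ≡⟨ cong (∑[ u < n G ] ∑[ v < n G ] forward-edge u v +_) (∑-comm (λ u v → forward-edge v u)) ⟩
    ∑[ u < n G ] ∑[ v < n G ] forward-edge u v + ∑[ v < n G ] ∑[ u < n G ] forward-edge v u
      ≡⟨ cong₂ _+_ edgeCount≡ edgeCount≡ ⟨
    edgeCount G + edgeCount G
      ∎

-- Tree walks have 3j + 1 edges, so they stay in their cell when M = 2 (3j + 1).
depth : ℕ → ℕ
depth j = suc (j * 3) + suc (j * 3)

-- An exit walk with at most depth j + 3j + 2 vertices, then a shortest walk to the next centre.
detourLength : ℕ → ℕ
detourLength j = depth j + (depth j + (2 + j * 3))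

module Density (G : Graph) (S : Subset (n G)) {g : ℕ} (girth : GirthAtLeast g G) where
  open Configurations G S

  dense-core-impossible : DenseCore → ∀ j {p q} → detourLength j + detourLength j ≤ suc g →
    (∀ H → ShallowMinor (depth j) H G → edgeCount H * q ^ depth j ≤ p ^ depth j * n H) →
    ¬ (2 * p ^ depth j < 2 ^ j * q ^ depth j)
  dense-core-impossible core j {p} {q} girth-large ∇-bound growth =
    <⇒≱ growth (*-cancelˡ-≤ K ⦃ nonZeroIndex (proj₁ (centres-cover v₀∈S)) ⦄ chain)
    where
    v₀∈S = proj₂ (DenseCore.nonempty core)
    M = depth j
    open Centres G S M
    open Voronoi G S M centres
    open Exits G S girth M centres
    open Handshake cellGraph

    E = edgeCount cellGraph
    P = p ^ M
    Q = q ^ M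

    degree≥ : ∀ i → 2 ^ j ≤ degree i
    degree≥ i = injective⇒≤-count (adj cellGraph i) exit-cell exit-cell-injective
                  (λ b → dec-true (touching? i (exit-cell b)) (exit-touching b))
      where
      open FromCentre centres-separated centre∈S centres-cover core (suc (j * 3)) j ≤-refl ≤-refl girth-large i

    degree-sum : K * 2 ^ j ≤ E + E
    degree-sum = subst₂ _≤_ (cong (_* 2 ^ j) (length-tabulate {n = K} id)) handshake
                   (sum-≥ degree (allFin K) degree≥)

    chain : K * (2 ^ j * Q) ≤ K * (2 * P)
    chain = begin
      K * (2 ^ j * Q) ≡⟨ *-assoc K (2 ^ j) Q ⟨
      K * 2 ^ j * Q   ≤⟨ *-monoˡ-≤ Q degree-sum ⟩
      (E + E) * Q     ≡⟨ *-distribʳ-+ Q E E ⟩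
      E * Q + E * Q   ≤⟨ +-mono-≤ (∇-bound cellGraph minor) (∇-bound cellGraph minor) ⟩
      P * K + P * K   ≡⟨ solve 2 (λ k x → x :* k :+ x :* k := k :* (con 2 :* x)) refl K P ⟩
      K * (2 * P)     ∎
      where
      open ≤-Reasoning
      minor = cellGraph-minor centres-separated centre∈S

C5²-arc? : ∀ i j → Dec (C5²-arc i j)
C5²-arc? i j = (toℕ j ℕ.≟ (toℕ i + 1) % 5) ⊎-dec (toℕ j ℕ.≟ (toℕ i + 2) % 5)

Arc : Bool → Fin 5 → Fin 5 → Set
Arc true  s t = C5²-arc s t
Arc false s t = C5²-arc t s

arc? : ∀ d s t → Dec (Arc d s t)
arc? true  s t = C5²-arc? s t
arc? false s t = C5²-arc? t s

∀-Bool? : ∀ {P : Bool → Set} → (∀ b → Dec (P b)) → Dec (∀ b → P b)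
∀-Bool? P? = map′ (λ (t , f) → λ { true → t ; false → f }) (λ h → h true , h false) (P? true ×-dec P? false)

-- Opaque, so that these proofs by evaluation are never unfolded where they are used.
opaque
  C5²-irreflexive : ∀ x → ¬ C5²-arc x x
  C5²-irreflexive = from-yes (all? λ x → ¬? (C5²-arc? x x))

  C5²-antisymmetric : ∀ x y → C5²-arc x y → ¬ C5²-arc y x
  C5²-antisymmetric = from-yes (all? λ x → all? λ y → C5²-arc? x y →-dec ¬? (C5²-arc? y x))

  C5²-neighbour : ∀ d t → ∃ λ s → Arc d s t
  C5²-neighbour = from-yes (∀-Bool? λ d → all? λ t → any? λ s → arc? d s t)

  C5²-walk₄ : ∀ x y d₁ d₂ d₃ d₄ → ∃ λ a → ∃ λ b → ∃ λ c → Arc d₁ x a × Arc d₂ a b × Arc d₃ b c × Arc d₄ c y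
  C5²-walk₄ = from-yes (all? λ x → all? λ y → ∀-Bool? λ d₁ → ∀-Bool? λ d₂ → ∀-Bool? λ d₃ → ∀-Bool? λ d₄ →
    any? λ a → any? λ b → any? λ c → arc? d₁ x a ×-dec arc? d₂ a b ×-dec arc? d₃ b c ×-dec arc? d₄ c y)

C5² : OrientedGraph 5
C5² = record
  { darc    = λ x y → does (C5²-arc? x y)
  ; irr     = λ x → dec-false (C5²-arc? x x) (C5²-irreflexive x)
  ; antisym = λ x y xy → dec-false (C5²-arc? y x) (C5²-antisymmetric x y (from-does (C5²-arc? x y) xy))
  }

-- Colouring by removing reducible configurations

module Colouring (G : Graph) (o : Orientation G) where
  open Walks G
  open Orientation o using (arc; arc⇒adj; antisym)

  IsHomOn : Subset (n G) → (Vertex → Fin 5) → Set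
  IsHomOn S φ = ∀ {u v} → u ∈ₛ S → v ∈ₛ S → arc u v ≡ true → C5²-arc (φ u) (φ v)

  Colouring : Subset (n G) → Set
  Colouring S = Σ (Vertex → Fin 5) (IsHomOn S)

  record Respects (ψ : Vertex → Fin 5) (x y : Vertex) : Set where
    constructor respects
    field
      forwards  : arc x y ≡ true → C5²-arc (ψ x) (ψ y)
      backwards : arc y x ≡ true → C5²-arc (ψ y) (ψ x)

  Respects-sym : ∀ {ψ x y} → Respects ψ x y → Respects ψ y x
  Respects-sym (respects f b) = respects b f

  Arc⇒Respects : ∀ {ψ : Vertex → Fin 5} x y {cx cy} → ψ x ≡ cx → ψ y ≡ cy → Arc (arc x y) cx cy → Respects ψ x y
  Arc⇒Respects x y refl refl h with arc x y in xy
  ... | true  = respects (λ _ → h) λ yx → contradiction (trans (sym yx) (antisym x y xy)) λ ()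
  ... | false = respects (λ xy′ → contradiction (trans (sym xy′) xy) λ ()) λ _ → h

  extend-hom : ∀ {S T : Subset (n G)} {R : Vertex → Set} {φ ψ : Vertex → Fin 5} → (∀ w → Dec (R w)) →
               (∀ {w} → w ∈ₛ S → ¬ R w → w ∈ₛ T) → (∀ {w} → ¬ R w → ψ w ≡ φ w) →
               (∀ {x y} → R x → y ∈ₛ S → Adj G x y → Respects ψ x y) → IsHomOn T φ → IsHomOn S ψ
  extend-hom {S} {T} {R} {φ} {ψ} R? kept agrees at-removed hom {u} {v} u∈ v∈ uv =
    Respects.forwards (edge-respected u∈ v∈ (arc⇒adj u v uv)) uv
    where
    edge-respected : ∀ {x y} → x ∈ₛ S → y ∈ₛ S → Adj G x y → Respects ψ x y
    edge-respected {x} {y} x∈ y∈ xy with R? x | R? y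
    ... | yes Rx | _      = at-removed Rx y∈ xy
    ... | no _   | yes Ry = Respects-sym (at-removed Ry x∈ (Adj-sym xy))
    ... | no ¬Rx | no ¬Ry = respects
      (λ xy′ → subst₂ C5²-arc (sym (agrees ¬Rx)) (sym (agrees ¬Ry)) (hom (kept x∈ ¬Rx) (kept y∈ ¬Ry) xy′))
      (λ yx′ → subst₂ C5²-arc (sym (agrees ¬Ry)) (sym (agrees ¬Rx)) (hom (kept y∈ ¬Ry) (kept x∈ ¬Rx) yx′))

  extend-pendant : ∀ {S v z} → (∀ w → w ∈ₛ S → Adj G v w → w ≡ z) → Colouring (S - v) → Colouring S
  extend-pendant {S} {v} {z} only-z (φ , hom) =
    ψ , extend-hom (_≟ v) x∈p∧x≢y⇒x∈p-y (λ {w} w≢v → updateAt-minimal w v φ w≢v) at-v hom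
    where
    col = proj₁ (C5²-neighbour (arc v z) (φ z))
    ψ = updateAt φ v (const col)
    at-v : ∀ {x y} → x ≡ v → y ∈ₛ S → Adj G x y → Respects ψ x y
    at-v refl y∈ vy with only-z _ y∈ vy
    ... | refl = Arc⇒Respects v z (updateAt-updates v φ) (updateAt-minimal z v φ (Adj⇒≢ vy ∘ sym))
                   (proj₂ (C5²-neighbour (arc v z) (φ z)))

  module _ (triangle-free : ∀ {a b c} → Adj G a b → Adj G b c → ¬ Adj G c a) where

    open Configurations G using (Thread; DenseCore; thread?; atMostOneNeighbour?; ¬AtMostOne⇒TwoNeighbours)

    extend-thread : ∀ {S u a b c v} → Thread S u a b c v → Colouring (S - a - b - c) → Colouring S
    extend-thread {S} {u} {a} {b} {c} {v} t (φ , hom)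
      with C5²-walk₄ (φ u) (φ v) (arc u a) (arc a b) (arc b c) (arc c v)
    ... | ca , cb , cc , h₁ , h₂ , h₃ , h₄
      with update₃ φ (Adj⇒≢ (Thread.ab t)) (Thread.a≢c t) (Adj⇒≢ (Thread.bc t)) ca cb cc
    ...   | ψ , ψa , ψb , ψc , ψ-elsewhere = ψ , extend-hom removed? kept agrees at-removed hom
      where
      open Thread S t
      Removed : Vertex → Set
      Removed w = w ≡ a ⊎ w ≡ b ⊎ w ≡ c
      removed? : ∀ w → Dec (Removed w)
      removed? w = (w ≟ a) ⊎-dec (w ≟ b) ⊎-dec (w ≟ c)
      kept : ∀ {w} → w ∈ₛ S → ¬ Removed w → w ∈ₛ S - a - b - c
      kept w∈ ¬R = x∈p∧x≢y⇒x∈p-y (x∈p∧x≢y⇒x∈p-y (x∈p∧x≢y⇒x∈p-y w∈ (¬R ∘ inj₁)) (¬R ∘ inj₂ ∘ inj₁)) (¬R ∘ inj₂ ∘ inj₂)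
      agrees : ∀ {w} → ¬ Removed w → ψ w ≡ φ w
      agrees ¬R = ψ-elsewhere (¬R ∘ inj₁) (¬R ∘ inj₂ ∘ inj₁) (¬R ∘ inj₂ ∘ inj₂)
      u-kept : ¬ Removed u
      u-kept = [ Adj⇒≢ ua , [ u≢b , (λ { refl → triangle-free ab bc ua }) ]′ ]′
      v-kept : ¬ Removed v
      v-kept = [ (λ { refl → triangle-free ab bc cv }) , [ b≢v ∘ sym , Adj⇒≢ cv ∘ sym ]′ ]′
      ua-respected = Arc⇒Respects u a (agrees u-kept) ψa h₁
      ab-respected = Arc⇒Respects a b ψa ψb h₂
      bc-respected = Arc⇒Respects b c ψb ψc h₃
      cv-respected = Arc⇒Respects c v ψc (agrees v-kept) h₄
      at-removed : ∀ {x y} → Removed x → y ∈ₛ S → Adj G x y → Respects ψ x y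
      at-removed (inj₁ refl) y∈ xy =
        [ (λ { refl → Respects-sym ua-respected }) , (λ { refl → ab-respected }) ]′ (only-a _ y∈ xy)
      at-removed (inj₂ (inj₁ refl)) y∈ xy =
        [ (λ { refl → Respects-sym ab-respected }) , (λ { refl → bc-respected }) ]′ (only-b _ y∈ xy)
      at-removed (inj₂ (inj₂ refl)) y∈ xy =
        [ (λ { refl → Respects-sym bc-respected }) , (λ { refl → cv-respected }) ]′ (only-c _ y∈ xy)

    colouring : (∀ S → ¬ DenseCore S) → ∀ S → Colouring S
    colouring no-core S = colour S (wellFounded ∣_∣ <-wellFounded S)
      where
      colour : ∀ S → Acc (_<_ on ∣_∣) S → Colouring S
      colour S (acc smaller) with nonempty? S
      ... | no empty = (λ _ → fzero) , λ u∈ _ _ → contradiction (_ , u∈) empty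
      ... | yes nonempty with any? (λ v → (v ∈ₛ? S) ×-dec atMostOneNeighbour? S v)
      ...   | yes (v , v∈ , z , only-z) = extend-pendant only-z (colour (S - v) (smaller {S - v} (x∈p⇒∣p-x∣<∣p∣ v∈)))
      ...   | no no-pendant with any? (λ u → any? λ a → any? λ b → any? λ c → any? λ v → thread? S u a b c v)
      ...     | yes (_ , a , b , c , _ , t) =
                extend-thread t (colour (S - a - b - c) (smaller {S - a - b - c} (∣p-x-y-z∣<∣p∣ b c (Thread.a∈S t))))
      ...     | no no-thread = ⊥-elim (no-core S record
                { nonempty   = nonempty
                ; min-degree = λ x∈ → ¬AtMostOne⇒TwoNeighbours S (λ pendant → no-pendant (_ , x∈ , pendant))
                ; no-thread  = λ t → no-thread (_ , _ , _ , _ , _ , t)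
                })

    hom-to-C5² : (∀ S → ¬ DenseCore S) → HomTo G o 5 C5²-arc
    hom-to-C5² no-core = φ , λ u v uv → hom ∈⊤ ∈⊤ uv
      where
      φ = proj₁ (colouring no-core ⊤)
      hom = proj₂ (colouring no-core ⊤)

-- The constants: 53/50 exceeds e^(1/20), and (53/50)^6 ≤ 2 makes 2 (53/50)^(depth j) < 2^j for j ≥ 3.

depth-suc : ∀ j → depth (suc j) ≡ depth j + 6
depth-suc = solve 1 (λ j → (con 4 :+ j :* con 3) :+ (con 4 :+ j :* con 3) :=
                           ((con 1 :+ j :* con 3) :+ (con 1 :+ j :* con 3)) :+ con 6) refl

module _ {a b : ℕ} .⦃ _ : NonZero a ⦄ (a⁶≤2b⁶ : a ^ 6 ≤ 2 * b ^ 6) where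

  growth-step : ∀ j → 2 * a ^ depth j < 2 ^ j * b ^ depth j → 2 * a ^ depth (suc j) < 2 ^ suc j * b ^ depth (suc j)
  growth-step j growth = begin-strict
    2 * a ^ depth (suc j)             ≡⟨ cong (λ d → 2 * a ^ d) (depth-suc j) ⟩
    2 * a ^ (depth j + 6)             ≡⟨ cong (2 *_) (^-distribˡ-+-* a (depth j) 6) ⟩
    2 * (a ^ depth j * a ^ 6)         ≡⟨ *-assoc 2 (a ^ depth j) (a ^ 6) ⟨
    2 * a ^ depth j * a ^ 6           <⟨ *-monoˡ-< (a ^ 6) ⦃ m^n≢0 a 6 ⦄ growth ⟩
    2 ^ j * b ^ depth j * a ^ 6       ≤⟨ *-monoʳ-≤ (2 ^ j * b ^ depth j) a⁶≤2b⁶ ⟩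
    2 ^ j * b ^ depth j * (2 * b ^ 6) ≡⟨ solve 4 (λ x y z w → (x :* y) :* (z :* w) := (z :* x) :* (y :* w))
                                           refl (2 ^ j) (b ^ depth j) 2 (b ^ 6) ⟩
    2 ^ suc j * (b ^ depth j * b ^ 6) ≡⟨ cong (2 ^ suc j *_) (^-distribˡ-+-* b (depth j) 6) ⟨
    2 ^ suc j * b ^ (depth j + 6)     ≡⟨ cong (λ d → 2 ^ suc j * b ^ d) (depth-suc j) ⟨
    2 ^ suc j * b ^ depth (suc j)     ∎
    where open ≤-Reasoning

growth : ∀ k → 2 * 53 ^ depth (k + 3) < 2 ^ (k + 3) * 50 ^ depth (k + 3)
growth zero    = from-yes (2 * 53 ^ depth 3 <? 2 ^ 3 * 50 ^ depth 3)
growth (suc k) = growth-step (from-yes (53 ^ 6 ≤? 2 * 50 ^ 6)) (k + 3) (growth k)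

53/50-above-e^1/20 : AboveE 53 50
53/50-above-e^1/20 = 3 , s≤s z≤n , from-yes (4 ^ 4 * 50 ^ 20 <? 53 ^ 20 * 3 ^ 4)

hom-to-C5²⇒oriented-chromatic : ∀ {G} → (∀ o → HomTo G o 5 C5²-arc) → OrientedChromaticAtMost 5 G
hom-to-C5²⇒oriented-chromatic hom o =
  5 , ≤-refl , C5² , φ , λ u v uv → dec-true (C5²-arc? (φ u) (φ v)) (proj₂ (hom o) u v uv)
  where φ = proj₁ (hom o)

mainTheorem5 : (C : GraphClass) → LimsupCondition C →
    ∃[ g ] (∀ G → C G → GirthAtLeast g G →
      OrientedChromaticAtMost 5 G × (∀ (o : Orientation G) → HomTo G o 5 C5²-arc))
mainTheorem5 C limsup = g , λ G G∈C girth → hom-to-C5²⇒oriented-chromatic (hom G G∈C girth) , hom G G∈C girth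
  where
  bounded = limsup 53 50 (s≤s z≤n) 53/50-above-e^1/20
  R = proj₁ bounded
  j = R + 3
  g = 4 + (detourLength j + detourLength j)
  R≤depth : R ≤ depth j
  R≤depth = ≤-trans (m≤m+n R 3) (≤-trans (m≤m*n j 3) (≤-trans (n≤1+n _) (m≤m+n _ _)))
  hom : ∀ G → C G → GirthAtLeast g G → ∀ o → HomTo G o 5 C5²-arc
  hom G G∈C girth o = Colouring.hom-to-C5² G o (Walks.Girth.triangle-free G girth (m≤m+n 4 _)) no-dense-core
    where
    no-dense-core : ∀ S → ¬ Configurations.DenseCore G S
    no-dense-core S core = Density.dense-core-impossible G S girth core j {53} {50} (≤-trans (m≤n+m _ 4) (n≤1+n _))
                             (proj₂ bounded (depth j) R≤depth G G∈C) (growth R)
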